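{- Let $K\ge1$ be an integer with $K\equiv \pm1\pmod 6$, and let $p_1^{a_1}\cdots p_r^{a_r}$ be the prime factorization of $K^2+4$. If $m>1$ is an integer with $\pi_K(m)=m$, then $m=24\cdot p_1^{j_1}\cdots p_r^{j_r}$ for some integers $j_1,\dots,j_r\ge0$.
   Context: The $K$-Fibonacci sequence is $F_{K,0}=0$, $F_{K,1}=1$, $F_{K,n}=K F_{K,n-1}+F_{K,n-2}$; for an integer $m>1$, $\pi_K(m)$ is the length of its shortest period modulo $m$. -}

module Defs where

open import Data.Nat using (ℕ; zero; suc; _+_; _*_; _%_; _<_; _≤_)
open import Relation.Binary.PropositionalEquality using (_≡_)

KFib : ℕ → ℕ → ℕ
KFib K zero = 0
KFib K (suc zero) = 1
KFib K (suc (suc n)) = K * KFib K (suc n) + KFib K n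

IsPeriod : (K m p : ℕ) → .{{_ : Data.Nat.NonZero m}} → Set
IsPeriod K m p = 0 < p × (∀ n → KFib K (n + p) % m ≡ KFib K n % m)
  where open import Data.Product using (_×_)

IsPisano : (K m p : ℕ) → .{{_ : Data.Nat.NonZero m}} → Set
IsPisano K m p = IsPeriod K m p × (∀ q → IsPeriod K m q → p ≤ q)
  where open import Data.Product using (_×_)

module Submission where

-- Write D = K² + 4. Since π(m) = m, the modulus m divides every period of F modulo m. Periods
-- modulo m are assembled from periods modulo the primes q ∣ m: a period T modulo q yields the
-- period q^(e-1) T modulo q^e, and periods modulo coprime moduli combine. For K ≡ ±1 (mod 6)
-- these prime periods are 3 for q = 2, 8 for q = 3, 4q for q ∣ D, and q - 1 or 2(q + 1) for the
-- remaining primes (Frobenius in ℤ[α], α² = Kα + 1). If p^(e+1) ∣ m, the period at p is prime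
-- to p and the periods at the other primes of m have p-adic valuation at most e, then the
-- assembled period is not divisible by p^(e+1), contradicting m ∣ π(m). This excludes the
-- largest prime p ∤ 6D dividing m (e = 0), 16 ∣ m (p = 2, e = 3) and 9 ∣ m (p = 3, e = 1).
-- Finally m is even by Cassini's identity, hence π(2) = 3 and then π(3) = 8 divide m, so
-- m = 24d with every prime factor of d dividing D.

open import Defs using (KFib; IsPeriod; IsPisano)

open import Algebra.Bundles using (CommutativeSemiring)
import Algebra.Structures.Biased
open import Data.Empty using (⊥; ⊥-elim)
import Data.Fin.Base as Fin
open import Data.Fin.Properties using (toℕ-inject₁; toℕ<n; toℕ-fromℕ)
open import Data.Integer.Base as ℤ using (ℤ; +_; 0ℤ; 1ℤ; -1ℤ; ∣_∣)
import Data.Integer.Divisibility.Signed as ℤ∣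
import Data.Integer.Properties as ℤ
open import Data.Integer.Tactic.RingSolver using (solve-∀; solve)
open import Data.List.Base using ([]; _∷_)
open import Data.List.Relation.Unary.All as All using (All)
open import Data.Nat.Base as ℕ using (ℕ; zero; suc; NonZero; NonTrivial; _!)
open import Data.Nat.Combinatorics using (_C_; k![n∸k]!∣n!; nCn≡1)
open import Data.Nat.Combinatorics.Specification using (nCk≡n!/k![n-k]!)
import Data.Nat.Coprimality as Coprimality
open Coprimality using (Coprime; coprime-divisor; 1-coprimeTo)
open import Data.Nat.DivMod using (_%_; _/_; m≡m%n+[m/n]*n; [m+kn]%n≡m%n; m%n<n; m/n*n≡m)
import Data.Nat.Divisibility as ℕ∣
open ℕ∣ using (_∣_; _∤_; divides)
open import Data.Nat.Induction using (<-rec)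
open import Data.Nat.ListAction using (product)
open import Data.Nat.ListAction.Properties using (∈⇒∣product)
open import Data.Nat.Primality
  using (Prime; prime?; prime[2]; ¬prime[1]; euclidsLemma; prime⇒irreducible; prime⇒nonZero; prime⇒nonTrivial)
open import Data.Nat.Primality.Factorisation using (PrimeFactorisation; factorise; factorisationHasAllPrimeFactors)
import Data.Nat.Properties as ℕ
import Data.Nat.Tactic.RingSolver as ℕ-Solver
open import Data.Product.Base using (Σ; _×_; _,_; proj₁; proj₂; ∃-syntax)
open import Data.Sum.Base as Sum using (_⊎_; inj₁; inj₂; [_,_]′)
open import Data.Vec.Functional using (init; last)
open import Function.Base using (_∘_; it)
open import Level using (0ℓ)
open import Relation.Binary.Bundles using (Setoid)
open import Relation.Binary.Definitions using (tri<; tri≈; tri>)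
open import Relation.Binary.PropositionalEquality
  using (_≡_; _≢_; refl; sym; trans; cong; cong₂; subst; subst₂; module ≡-Reasoning)
import Relation.Binary.Reasoning.Setoid as SetoidReasoning
open import Relation.Binary.Structures using (IsEquivalence)
open import Relation.Nullary using (¬_; yes; no)
open import Relation.Nullary.Decidable using (from-yes; from-no)
open import Relation.Nullary.Negation using (contradiction)

prime[3] : Prime 3
prime[3] = from-yes (prime? 3)

prime∣prime⇒≡ : ∀ {p q} → Prime p → Prime q → p ∣ q → p ≡ q
prime∣prime⇒≡ p-prime q-prime p∣q with prime⇒irreducible q-prime p∣q
... | inj₁ refl = contradiction p-prime ¬prime[1]
... | inj₂ p≡q = p≡q

prime∤^ : ∀ {p a} → Prime p → p ∤ a → ∀ n → p ∤ a ℕ.^ n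
prime∤^ p-prime p∤a zero p∣1 = contradiction (subst Prime (ℕ∣.∣1⇒≡1 p∣1) p-prime) ¬prime[1]
prime∤^ {a = a} p-prime p∤a (suc n) = [ p∤a , prime∤^ p-prime p∤a n ]′ ∘ euclidsLemma a (a ℕ.^ n) p-prime

prime∤⇒coprime : ∀ {p n} → Prime p → p ∤ n → Coprime p n
prime∤⇒coprime p-prime p∤n (d∣p , d∣n) with prime⇒irreducible p-prime d∣p
... | inj₁ d≡1 = d≡1
... | inj₂ refl = contradiction d∣n p∤n

coprime-*ˡ : ∀ {a b c} → Coprime a c → Coprime b c → Coprime (a ℕ.* b) c
coprime-*ˡ {a} {b} {c} a⊥c b⊥c (d∣ab , d∣c) = b⊥c (coprime-divisor d⊥a d∣ab , d∣c)
  where d⊥a : Coprime _ a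
        d⊥a (e∣d , e∣a) = a⊥c (e∣a , ℕ∣.∣-trans e∣d d∣c)

coprime-^ : ∀ {a c} → Coprime a c → ∀ n → Coprime (a ℕ.^ n) c
coprime-^ {c = c} a⊥c zero = 1-coprimeTo c
coprime-^ a⊥c (suc n) = coprime-*ˡ a⊥c (coprime-^ a⊥c n)

coprime⇒*-∣ : ∀ {a b n} → Coprime a b → a ∣ n → b ∣ n → a ℕ.* b ∣ n
coprime⇒*-∣ {a} {b} coprime (divides t refl) b∣ta
  with coprime-divisor (Coprimality.sym coprime) (subst (b ∣_) (ℕ.*-comm t a) b∣ta)
... | divides u refl = divides u (trans (ℕ.*-assoc u b a) (cong (u ℕ.*_) (ℕ.*-comm b a)))

even-or-odd : ∀ n → 2 ∣ n ⊎ ∃[ t ] n ≡ suc (2 ℕ.* t)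
even-or-odd zero = inj₁ (divides 0 refl)
even-or-odd (suc zero) = inj₂ (0 , refl)
even-or-odd (suc (suc n)) with even-or-odd n
... | inj₁ (divides q refl) = inj₁ (divides (suc q) refl)
... | inj₂ (t , refl) = inj₂ (suc t , cong suc (sym (ℕ.*-suc 2 t)))

odd-prime : ∀ {q} → Prime q → q ≢ 2 → ∃[ r ] q ≡ suc (2 ℕ.* r)
odd-prime {q} q-prime q≢2 with even-or-odd q
... | inj₁ 2∣q = contradiction (sym (prime∣prime⇒≡ prime[2] q-prime 2∣q)) q≢2
... | inj₂ odd = odd

p-adic : ∀ {p} .{{_ : NonTrivial p}} n .{{_ : NonZero n}} → ∃[ j ] ∃[ r ] (n ≡ p ℕ.^ j ℕ.* r × p ∤ r)
p-adic {p} n {{n≢0}} = <-rec (λ n → .(NonZero n) → ∃[ j ] ∃[ r ] (n ≡ p ℕ.^ j ℕ.* r × p ∤ r)) step n n≢0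
  where
  step : ∀ n → (∀ {n′} → n′ ℕ.< n → .(NonZero n′) → ∃[ j ] ∃[ r ] (n′ ≡ p ℕ.^ j ℕ.* r × p ∤ r)) →
         .(NonZero n) → ∃[ j ] ∃[ r ] (n ≡ p ℕ.^ j ℕ.* r × p ∤ r)
  step n rec n≢0 with p ℕ∣.∣? n
  ... | no p∤n = 0 , n , sym (ℕ.*-identityˡ n) , p∤n
  ... | yes p∣n with rec (ℕ∣.quotient-< p∣n {{it}} {{n≢0}}) (ℕ∣.quotient≢0 p∣n {{n≢0}})
  ...   | j , r , n′≡pʲr , p∤r = suc j , r , n≡pʲ⁺¹r , p∤r
    where n≡pʲ⁺¹r : n ≡ p ℕ.^ suc j ℕ.* r
          n≡pʲ⁺¹r = trans (ℕ∣.m∣n⇒n≡m*quotient p∣n) (trans (cong (p ℕ.*_) n′≡pʲr) (sym (ℕ.*-assoc p (p ℕ.^ j) r)))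

downward-induction : ∀ {ℓ} (P : ℕ → Set ℓ) b → (∀ n → (∀ {k} → n ℕ.< k → k ℕ.≤ b → P k) → P n) → ∀ n → P n
downward-induction P b step n = go (b ℕ.∸ n) n ℕ.≤-refl
  where
  go : ∀ d n → b ℕ.∸ n ℕ.≤ d → P n
  go zero    n b∸n≤0 = step n λ n<k k≤b → contradiction (ℕ.≤-trans (ℕ.∸-monoʳ-< n<k k≤b) b∸n≤0) ℕ.n≮0
  go (suc d) n b∸n≤d = step n λ n<k k≤b → go d _ (ℕ.≤-pred (ℕ.≤-trans (ℕ.∸-monoʳ-< n<k k≤b) b∸n≤d))

∣∸⇒%≡% : ∀ {a b m} .{{_ : NonZero m}} → b ℕ.≤ a → m ∣ a ℕ.∸ b → a % m ≡ b % m
∣∸⇒%≡% {a} {b} {m} b≤a (divides k a∸b≡km) = begin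
  a % m             ≡⟨ cong (_% m) a≡b+km ⟩
  (b ℕ.+ k ℕ.* m) % m ≡⟨ [m+kn]%n≡m%n b k m ⟩
  b % m             ∎
  where
  open ≡-Reasoning
  a≡b+km : a ≡ b ℕ.+ k ℕ.* m
  a≡b+km = trans (sym (ℕ.m+[n∸m]≡n b≤a)) (cong (b ℕ.+_) a∸b≡km)

prime∣n!⇒≤ : ∀ {p} n → Prime p → p ∣ n ! → p ℕ.≤ n
prime∣n!⇒≤ zero p-prime p∣1 = contradiction (subst Prime (ℕ∣.∣1⇒≡1 p∣1) p-prime) ¬prime[1]
prime∣n!⇒≤ (suc n) p-prime p∣n! with euclidsLemma (suc n) (n !) p-prime p∣n!
... | inj₁ p∣1+n = ℕ∣.∣⇒≤ p∣1+n
... | inj₂ p∣n!′ = ℕ.m≤n⇒m≤1+n (prime∣n!⇒≤ n p-prime p∣n!′)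

prime∣binomial : ∀ {p k} → Prime p → 0 ℕ.< k → k ℕ.< p → p ∣ p C k
prime∣binomial {p} {k} p-prime 0<k k<p =
  [ (λ p∣C → p∣C) , ⊥-elim ∘ [ p∤k! , p∤[p-k]! ]′ ∘ euclidsLemma (k !) ((p ℕ.∸ k) !) p-prime ]′
    (euclidsLemma (p C k) (k ! ℕ.* (p ℕ.∸ k) !) p-prime
      (subst (p ∣_) (sym C*k!*[p-k]!≡p!) (n∣n! {{prime⇒nonZero p-prime}})))
  where
  C*k!*[p-k]!≡p! : (p C k) ℕ.* (k ! ℕ.* (p ℕ.∸ k) !) ≡ p !
  C*k!*[p-k]!≡p! = trans (cong (ℕ._* (k ! ℕ.* (p ℕ.∸ k) !)) (nCk≡n!/k![n-k]! (ℕ.<⇒≤ k<p)))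
                         (m/n*n≡m {{k ℕ.!* p ℕ.∸ k !≢0}} (k![n∸k]!∣n! (ℕ.<⇒≤ k<p)))
  n∣n! : ∀ {n} .{{_ : NonZero n}} → n ∣ n !
  n∣n! {suc n} = ℕ∣.m∣m*n (n !)
  p∤k! : p ∤ k !
  p∤k! p∣k! = ℕ.<⇒≱ k<p (prime∣n!⇒≤ k p-prime p∣k!)
  p∤[p-k]! : p ∤ (p ℕ.∸ k) !
  p∤[p-k]! p∣[p-k]! = ℕ.<⇒≱ (ℕ.∸-monoʳ-< 0<k (ℕ.<⇒≤ k<p)) (prime∣n!⇒≤ (p ℕ.∸ k) p-prime p∣[p-k]!)

-- Frobenius in characteristic p

module Characteristic {c ℓ} (S : CommutativeSemiring c ℓ) {p : ℕ} (p-prime : Prime p) where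

  open CommutativeSemiring S
    using ( Carrier; _≈_; _+_; _*_; 0#; 1#; setoid; semiring; +-monoid; *-monoid
          ; +-cong; +-congˡ; +-comm; +-identityˡ; *-identityˡ; *-identityʳ; zeroˡ)
    renaming (trans to ≈-trans)
  open import Algebra.Properties.Semiring.Exp semiring using (_^_)
  open import Algebra.Properties.Monoid.Mult +-monoid using (×-assocˡ; ×-homo-1) renaming (_×_ to _·_)
  open import Algebra.Properties.Monoid.Mult *-monoid using (×-idem)
  open import Algebra.Properties.Monoid.Sum +-monoid using (sum; sum-init-last; sum-cong-≋; sum-replicate-zero)
  open import Algebra.Properties.CommutativeSemiring.Binomial S using (theorem; binomialTerm)
  open SetoidReasoning setoid

  module _ (char : ∀ x → p · x ≈ 0#) where

    binomial-vanishes : ∀ {k} z → 0 ℕ.< k → k ℕ.< p → (p C k) · z ≈ 0#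
    binomial-vanishes {k} z 0<k k<p with prime∣binomial p-prime 0<k k<p
    ... | divides a pCk≡ap = begin
      (p C k) · z       ≡⟨ cong (_· z) (trans pCk≡ap (ℕ.*-comm a p)) ⟩
      (p ℕ.* a) · z     ≈⟨ ×-assocˡ z p a ⟨
      p · (a · z)       ≈⟨ char (a · z) ⟩
      0#                ∎

    frobenius : ∀ x y → (x + y) ^ p ≈ x ^ p + y ^ p
    frobenius x y = expand p refl
      where
      expand : ∀ n → n ≡ p → (x + y) ^ n ≈ x ^ n + y ^ n
      expand (suc n) refl = begin
        (x + y) ^ p                                               ≈⟨ theorem p x y ⟩
        t Fin.zero + sum (t ∘ Fin.suc)                            ≈⟨ +-congˡ (sum-init-last (t ∘ Fin.suc)) ⟩
        t Fin.zero + (sum (init (t ∘ Fin.suc)) + last (t ∘ Fin.suc)) ≈⟨ +-cong first (+-cong middle top) ⟩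
        y ^ p + (0# + x ^ p)                                      ≈⟨ +-congˡ (+-identityˡ (x ^ p)) ⟩
        y ^ p + x ^ p                                             ≈⟨ +-comm (y ^ p) (x ^ p) ⟩
        x ^ p + y ^ p                                             ∎
        where
        t : Fin.Fin (suc p) → Carrier
        t = binomialTerm x y p
        first : t Fin.zero ≈ y ^ p
        first = ≈-trans (×-homo-1 _) (*-identityˡ (y ^ p))
        middle : sum (init (t ∘ Fin.suc)) ≈ 0#
        middle = ≈-trans (sum-cong-≋ λ i → binomial-vanishes _ (ℕ.s≤s ℕ.z≤n)
                   (ℕ.s≤s (subst (ℕ._< n) (sym (toℕ-inject₁ i)) (toℕ<n i)))) (sum-replicate-zero n)
        top-term : ∀ j → j ≡ p → (p C j) · (x ^ j * y ^ (p ℕ.∸ j)) ≈ x ^ p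
        top-term j refl rewrite nCn≡1 p | ℕ.n∸n≡0 p = ≈-trans (×-homo-1 _) (*-identityʳ (x ^ p))
        top : last (t ∘ Fin.suc) ≈ x ^ p
        top = top-term _ (cong suc (toℕ-fromℕ n))

    fermat : ∀ n → (n · 1#) ^ p ≈ n · 1#
    fermat zero = zero-power p refl
      where zero-power : ∀ n → n ≡ p → 0# ^ n ≈ 0#
            zero-power (suc n) refl = zeroˡ (0# ^ n)
    fermat (suc n) = begin
      (1# + n · 1#) ^ p     ≈⟨ frobenius 1# (n · 1#) ⟩
      1# ^ p + (n · 1#) ^ p ≈⟨ +-cong (×-idem (*-identityˡ 1#) p {{prime⇒nonZero p-prime}}) (fermat n) ⟩
      1# + n · 1#           ∎

open import Data.Integer.Base using (_+_; _*_; _-_; -_; _^_)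

-- Congruences of integers

infix 4 _≡_mod_
record _≡_mod_ (a b m : ℤ) : Set where
  constructor mod-intro
  field ∣difference : m ℤ∣.∣ a - b
open _≡_mod_

module _ {m : ℤ} where

  ∣⇒≡0-mod : ∀ {a} → m ℤ∣.∣ a → a ≡ 0ℤ mod m
  ∣⇒≡0-mod {a} = mod-intro ∘ subst (m ℤ∣.∣_) (sym (ℤ.+-identityʳ a))

  ≡0-mod⇒∣ : ∀ {a} → a ≡ 0ℤ mod m → m ℤ∣.∣ a
  ≡0-mod⇒∣ {a} = subst (m ℤ∣.∣_) (ℤ.+-identityʳ a) ∘ ∣difference

  difference≡0⇒mod : ∀ {a b} → a - b ≡ 0ℤ mod m → a ≡ b mod m
  difference≡0⇒mod = mod-intro ∘ ≡0-mod⇒∣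

  ≡⇒mod : ∀ {a b} → a ≡ b → a ≡ b mod m
  ≡⇒mod {a} refl = mod-intro (ℤ∣.divides 0ℤ (trans (ℤ.+-inverseʳ a) (sym (ℤ.*-zeroˡ m))))

  mod-refl : ∀ {a} → a ≡ a mod m
  mod-refl = ≡⇒mod refl

  mod-sym : ∀ {a b} → a ≡ b mod m → b ≡ a mod m
  mod-sym {a} {b} (mod-intro p) = mod-intro (subst (m ℤ∣.∣_) (negate a b) (ℤ∣.∣m⇒∣-m p))
    where negate : ∀ a b → - (a - b) ≡ b - a
          negate = solve-∀

  mod-trans : ∀ {a b c} → a ≡ b mod m → b ≡ c mod m → a ≡ c mod m
  mod-trans {a} {b} {c} (mod-intro p) (mod-intro q) =
    mod-intro (subst (m ℤ∣.∣_) (telescope a b c) (ℤ∣.∣m∣n⇒∣m+n p q))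
    where telescope : ∀ a b c → (a - b) + (b - c) ≡ a - c
          telescope = solve-∀

  mod-+ : ∀ {a b c d} → a ≡ b mod m → c ≡ d mod m → a + c ≡ b + d mod m
  mod-+ {a} {b} {c} {d} (mod-intro p) (mod-intro q) =
    mod-intro (subst (m ℤ∣.∣_) (regroup a b c d) (ℤ∣.∣m∣n⇒∣m+n p q))
    where regroup : ∀ a b c d → (a - b) + (c - d) ≡ (a + c) - (b + d)
          regroup = solve-∀

  mod-neg : ∀ {a b} → a ≡ b mod m → - a ≡ - b mod m
  mod-neg {a} {b} (mod-intro p) = mod-intro (subst (m ℤ∣.∣_) (negate a b) (ℤ∣.∣m⇒∣-m p))
    where negate : ∀ a b → - (a - b) ≡ - a - - b
          negate = solve-∀

  mod-- : ∀ {a b c d} → a ≡ b mod m → c ≡ d mod m → a - c ≡ b - d mod m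
  mod-- p q = mod-+ p (mod-neg q)

  mod-* : ∀ {a b c d} → a ≡ b mod m → c ≡ d mod m → a * c ≡ b * d mod m
  mod-* {a} {b} {c} {d} (mod-intro p) (mod-intro q) =
    mod-intro (subst (m ℤ∣.∣_) (expand a b c d) (ℤ∣.∣m∣n⇒∣m+n (ℤ∣.∣n⇒∣m*n a q) (ℤ∣.∣m⇒∣m*n d p)))
    where expand : ∀ a b c d → a * (c - d) + (a - b) * d ≡ a * c - b * d
          expand = solve-∀

  mod-*ˡ : ∀ a {b c} → b ≡ c mod m → a * b ≡ a * c mod m
  mod-*ˡ a = mod-* (mod-refl {a})

  mod-*ʳ : ∀ a {b c} → b ≡ c mod m → b * a ≡ c * a mod m
  mod-*ʳ a p = mod-* p (mod-refl {a})

  mod-+ˡ : ∀ a {b c} → b ≡ c mod m → a + b ≡ a + c mod m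
  mod-+ˡ a = mod-+ (mod-refl {a})

  mod-+ʳ : ∀ a {b c} → b ≡ c mod m → b + a ≡ c + a mod m
  mod-+ʳ a p = mod-+ p (mod-refl {a})

  mod-^ : ∀ {a b} n → a ≡ b mod m → a ^ n ≡ b ^ n mod m
  mod-^ zero    p = mod-refl
  mod-^ (suc n) p = mod-* p (mod-^ n p)

  mod-multiple : ∀ a → a * m ≡ 0ℤ mod m
  mod-multiple a = ∣⇒≡0-mod (ℤ∣.divides a refl)

  mod-self : m ≡ 0ℤ mod m
  mod-self = ∣⇒≡0-mod ℤ∣.∣-refl

mod-setoid : ℤ → Setoid _ _
mod-setoid m = record
  { Carrier = ℤ
  ; _≈_ = _≡_mod m
  ; isEquivalence = record { refl = mod-refl ; sym = mod-sym ; trans = mod-trans }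
  }

module ModReasoning (m : ℤ) = SetoidReasoning (mod-setoid m)

mod-∣ : ∀ {d m a b} → d ℤ∣.∣ m → a ≡ b mod m → a ≡ b mod d
mod-∣ d∣m (mod-intro p) = mod-intro (ℤ∣.∣-trans d∣m p)

mod-∣ℕ : ∀ {d m a b} → d ∣ m → a ≡ b mod + m → a ≡ b mod + d
mod-∣ℕ d∣m = mod-∣ (ℤ∣.∣ᵤ⇒∣ d∣m)

mod-*-zero : ∀ {s t a b} → a ≡ 0ℤ mod s → b ≡ 0ℤ mod t → a * b ≡ 0ℤ mod s * t
mod-*-zero {s} {t} a≡0 b≡0 with ≡0-mod⇒∣ a≡0 | ≡0-mod⇒∣ b≡0
... | ℤ∣.divides x refl | ℤ∣.divides y refl = ∣⇒≡0-mod (ℤ∣.divides (x * y) (interchange x s y t))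
  where interchange : ∀ x s y t → x * s * (y * t) ≡ x * y * (s * t)
        interchange = solve-∀

mod-crt : ∀ {a b x y} → Coprime a b → x ≡ y mod + a → x ≡ y mod + b → x ≡ y mod + (a ℕ.* b)
mod-crt coprime (mod-intro a∣) (mod-intro b∣) =
  mod-intro (ℤ∣.∣ᵤ⇒∣ (coprime⇒*-∣ coprime (ℤ∣.∣⇒∣ᵤ a∣) (ℤ∣.∣⇒∣ᵤ b∣)))

mod-euclid : ∀ {p a b} → Prime p → a * b ≡ 0ℤ mod + p → a ≡ 0ℤ mod + p ⊎ b ≡ 0ℤ mod + p
mod-euclid {p} {a} {b} p-prime ab≡0 with euclidsLemma ∣ a ∣ ∣ b ∣ p-prime p∣∣ab∣
  where p∣∣ab∣ : p ∣ ∣ a ∣ ℕ.* ∣ b ∣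
        p∣∣ab∣ = subst (p ∣_) (ℤ.abs-* a b) (ℤ∣.∣⇒∣ᵤ (≡0-mod⇒∣ ab≡0))
... | inj₁ p∣a = inj₁ (∣⇒≡0-mod (ℤ∣.∣ᵤ⇒∣ p∣a))
... | inj₂ p∣b = inj₂ (∣⇒≡0-mod (ℤ∣.∣ᵤ⇒∣ p∣b))

mod-cancelˡ : ∀ {p a x y} → Prime p → p ∤ a → + a * x ≡ + a * y mod + p → x ≡ y mod + p
mod-cancelˡ {p} {a} {x} {y} p-prime p∤a (mod-intro p∣ax-ay) with mod-euclid {a = + a} p-prime a[x-y]≡0
  where
  a[x-y]≡0 : + a * (x - y) ≡ 0ℤ mod + p
  a[x-y]≡0 = ∣⇒≡0-mod (subst (+ p ℤ∣.∣_) (factor (+ a) x y) p∣ax-ay)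
    where factor : ∀ a x y → a * x - a * y ≡ a * (x - y)
          factor = solve-∀
... | inj₁ a≡0   = contradiction (ℤ∣.∣⇒∣ᵤ (≡0-mod⇒∣ a≡0)) p∤a
... | inj₂ x-y≡0 = difference≡0⇒mod x-y≡0

∣⇒≡0-mod-ℕ : ∀ {m a} → m ∣ a → + a ≡ 0ℤ mod + m
∣⇒≡0-mod-ℕ m∣a = ∣⇒≡0-mod (ℤ∣.∣ᵤ⇒∣ m∣a)

mod-1 : ∀ {a b} → a ≡ b mod 1ℤ
mod-1 {a} {b} = mod-intro (ℤ∣.divides (a - b) (sym (ℤ.*-identityʳ (a - b))))

mod⇒∣∸ : ∀ {a b m} → b ℕ.≤ a → + a ≡ + b mod + m → m ∣ a ℕ.∸ b
mod⇒∣∸ {a} {b} {m} b≤a (mod-intro m∣a-b) =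
  subst (m ∣_) (cong ∣_∣ (trans (ℤ.m-n≡m⊖n a b) (ℤ.⊖-≥ b≤a))) (ℤ∣.∣⇒∣ᵤ m∣a-b)

mod⇒%≡% : ∀ {a b m} .{{_ : NonZero m}} → + a ≡ + b mod + m → a % m ≡ b % m
mod⇒%≡% {a} {b} a≡b with ℕ.≤-total b a
... | inj₁ b≤a = ∣∸⇒%≡% b≤a (mod⇒∣∸ b≤a a≡b)
... | inj₂ a≤b = sym (∣∸⇒%≡% a≤b (mod⇒∣∸ a≤b (mod-sym a≡b)))

%≡%⇒mod : ∀ {a b m} .{{_ : NonZero m}} → a % m ≡ b % m → + a ≡ + b mod + m
%≡%⇒mod {a} {b} {m} a%m≡b%m = mod-intro (ℤ∣.divides (+ (a / m) - + (b / m)) (begin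
  + a - + b
    ≡⟨ cong₂ _-_ (division a) (division b) ⟩
  (+ (a % m) + + (a / m) * + m) - (+ (b % m) + + (b / m) * + m)
    ≡⟨ cong (λ r → (+ r + + (a / m) * + m) - (+ (b % m) + + (b / m) * + m)) a%m≡b%m ⟩
  (+ (b % m) + + (a / m) * + m) - (+ (b % m) + + (b / m) * + m)
    ≡⟨ cancel (+ (b % m)) (+ (a / m)) (+ (b / m)) (+ m) ⟩
  (+ (a / m) - + (b / m)) * + m ∎))
  where
  open ≡-Reasoning
  division : ∀ n → + n ≡ + (n % m) + + (n / m) * + m
  division n = trans (cong +_ (m≡m%n+[m/n]*n n m)) (cong (_+_ (+ (n % m))) (ℤ.pos-* (n / m) m))
  cancel : ∀ r x y m → (r + x * m) - (r + y * m) ≡ (x - y) * m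
  cancel = solve-∀

fib : ℤ → ℕ → ℤ
fib k zero = 0ℤ
fib k (suc zero) = 1ℤ
fib k (suc (suc n)) = k * fib k (suc n) + fib k n

-- fibPrev k n is F(n - 1), with F(-1) = 1.
fibPrev : ℤ → ℕ → ℤ
fibPrev k zero = 1ℤ
fibPrev k (suc n) = fib k n

KFib≡fib : ∀ K n → + KFib K n ≡ fib (+ K) n
KFib≡fib K zero = refl
KFib≡fib K (suc zero) = refl
KFib≡fib K (suc (suc n)) = begin
  + (K ℕ.* KFib K (suc n) ℕ.+ KFib K n)  ≡⟨ ℤ.pos-+ (K ℕ.* KFib K (suc n)) (KFib K n) ⟩
  + (K ℕ.* KFib K (suc n)) + + KFib K n  ≡⟨ cong (_+ + KFib K n) (ℤ.pos-* K (KFib K (suc n))) ⟩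
  + K * + KFib K (suc n) + + KFib K n    ≡⟨ cong₂ (λ x y → + K * x + y) (KFib≡fib K (suc n)) (KFib≡fib K n) ⟩
  fib (+ K) (suc (suc n))                ∎
  where open ≡-Reasoning

fib-suc : ∀ k n → fib k (suc n) ≡ k * fib k n + fibPrev k n
fib-suc k zero = solve (k ∷ [])
fib-suc k (suc n) = refl

Recurrent : ℤ → (ℕ → ℤ) → Set
Recurrent k u = ∀ n → u (2 ℕ.+ n) ≡ k * u (1 ℕ.+ n) + u n

fib-recurrent : ∀ k → Recurrent k (fib k)
fib-recurrent k n = refl

addition-formula : ∀ {k u} → Recurrent k u → ∀ T n → u (T ℕ.+ n) ≡ u (suc n) * fib k T + u n * fibPrev k T
addition-formula {k} {u} rec zero n = solve-at (u n) (u (suc n))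
  where solve-at : ∀ x y → x ≡ y * 0ℤ + x * 1ℤ
        solve-at = solve-∀
addition-formula {k} {u} rec (suc zero) n = solve-at (u n) (u (suc n))
  where solve-at : ∀ x y → y ≡ y * 1ℤ + x * 0ℤ
        solve-at = solve-∀
addition-formula {k} {u} rec (suc (suc T)) n = begin
  u (2 ℕ.+ (T ℕ.+ n))
    ≡⟨ rec (T ℕ.+ n) ⟩
  k * u (suc T ℕ.+ n) + u (T ℕ.+ n)
    ≡⟨ cong₂ (λ a b → k * a + b) (addition-formula {k} {u} rec (suc T) n) (addition-formula {k} {u} rec T n) ⟩
  k * (y * fib k (suc T) + x * fib k T) + (y * fib k T + x * fibPrev k T)
    ≡⟨ regroup k x y (fib k (suc T)) (fib k T) (fibPrev k T) ⟩
  y * (k * fib k (suc T) + fib k T) + x * (k * fib k T + fibPrev k T)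
    ≡⟨ cong (λ a → y * (k * fib k (suc T) + fib k T) + x * a) (sym (fib-suc k T)) ⟩
  y * fib k (2 ℕ.+ T) + x * fib k (suc T) ∎
  where
  open ≡-Reasoning
  x y : ℤ
  x = u n
  y = u (suc n)
  regroup : ∀ k x y F₁ F₀ G₀ →
            k * (y * F₁ + x * F₀) + (y * F₀ + x * G₀) ≡ y * (k * F₁ + F₀) + x * (k * F₀ + G₀)
  regroup = solve-∀

cassini : ∀ k n → fib k (2 ℕ.+ n) * fib k n - fib k (1 ℕ.+ n) * fib k (1 ℕ.+ n) ≡ - (-1ℤ ^ n)
cassini k zero = cong (_- 1ℤ) (ℤ.*-zeroʳ (fib k 2))
cassini k (suc n) = begin
  fib k (3 ℕ.+ n) * fib k (1 ℕ.+ n) - fib k (2 ℕ.+ n) * fib k (2 ℕ.+ n)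
    ≡⟨ negated k (fib k (suc n)) (fib k n) ⟩
  - (fib k (2 ℕ.+ n) * fib k n - fib k (1 ℕ.+ n) * fib k (1 ℕ.+ n))
    ≡⟨ cong -_ (cassini k n) ⟩
  - - (-1ℤ ^ n)
    ≡⟨ sign-flip (-1ℤ ^ n) ⟩
  - (-1ℤ ^ suc n) ∎
  where
  open ≡-Reasoning
  negated : ∀ k x y → (k * (k * x + y) + x) * x - (k * x + y) * (k * x + y) ≡ - ((k * x + y) * y - x * x)
  negated = solve-∀
  sign-flip : ∀ s → - - s ≡ - (-1ℤ * s)
  sign-flip = solve-∀

-- Periods

Periodic : (ℕ → ℤ) → ℤ → ℕ → Set
Periodic u m N = ∀ n → u (n ℕ.+ N) ≡ u n mod m

Period : ℤ → ℕ → ℕ → Set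
Period k m N = Periodic (fib k) (+ m) N

module _ {u : ℕ → ℤ} {m : ℤ} where

  periodic-0 : Periodic u m 0
  periodic-0 n = ≡⇒mod (cong u (ℕ.+-identityʳ n))

  periodic-+ : ∀ {a b} → Periodic u m a → Periodic u m b → Periodic u m (a ℕ.+ b)
  periodic-+ {a} {b} per-a per-b n = begin
    u (n ℕ.+ (a ℕ.+ b)) ≡⟨ cong u (sym (ℕ.+-assoc n a b)) ⟩
    u (n ℕ.+ a ℕ.+ b)   ≈⟨ per-b (n ℕ.+ a) ⟩
    u (n ℕ.+ a)         ≈⟨ per-a n ⟩
    u n                 ∎
    where open ModReasoning m

  periodic-∸ : ∀ {a b} → Periodic u m (a ℕ.+ b) → Periodic u m b → Periodic u m a
  periodic-∸ {a} {b} per-ab per-b n = begin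
    u (n ℕ.+ a)         ≈⟨ per-b (n ℕ.+ a) ⟨
    u (n ℕ.+ a ℕ.+ b)   ≡⟨ cong u (ℕ.+-assoc n a b) ⟩
    u (n ℕ.+ (a ℕ.+ b)) ≈⟨ per-ab n ⟩
    u n                 ∎
    where open ModReasoning m

  periodic-* : ∀ {a} j → Periodic u m a → Periodic u m (j ℕ.* a)
  periodic-* zero    per = periodic-0
  periodic-* (suc j) per = periodic-+ per (periodic-* j per)

  periodic-∣ : ∀ {a b} → a ∣ b → Periodic u m a → Periodic u m b
  periodic-∣ (divides j refl) per = periodic-* j per

periodic-mod-∣ : ∀ {u d m N} → d ℤ∣.∣ m → Periodic u m N → Periodic u d N
periodic-mod-∣ d∣m per n = mod-∣ d∣m (per n)

periodic-crt : ∀ {u a b N} → Coprime a b → Periodic u (+ a) N → Periodic u (+ b) N → Periodic u (+ (a ℕ.* b)) N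
periodic-crt coprime per-a per-b n = mod-crt coprime (per-a n) (per-b n)

period-mod-∣ : ∀ {k d m N} → d ∣ m → Period k m N → Period k d N
period-mod-∣ d∣m = periodic-mod-∣ (ℤ∣.∣ᵤ⇒∣ d∣m)

fib-cong : ∀ {k k′ m} → k ≡ k′ mod m → ∀ n → fib k n ≡ fib k′ n mod m
fib-cong k≡k′ zero = mod-refl
fib-cong k≡k′ (suc zero) = mod-refl
fib-cong k≡k′ (suc (suc n)) = mod-+ (mod-* k≡k′ (fib-cong k≡k′ (suc n))) (fib-cong k≡k′ n)

period-cong : ∀ {k k′ m N} → k ≡ k′ mod + m → Period k m N → Period k′ m N
period-cong {k} {k′} {m} {N} k≡k′ per n = begin
  fib k′ (n ℕ.+ N) ≈⟨ fib-cong k≡k′ (n ℕ.+ N) ⟨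
  fib k (n ℕ.+ N)  ≈⟨ per n ⟩
  fib k n          ≈⟨ fib-cong k≡k′ n ⟩
  fib k′ n         ∎
  where open ModReasoning (+ m)

fib-shift : ∀ {k m N s} → fib k N ≡ 0ℤ mod m → fibPrev k N ≡ s mod m → ∀ n → fib k (n ℕ.+ N) ≡ s * fib k n mod m
fib-shift {k} {m} {N} {s} F≡0 G≡s n = begin
  fib k (n ℕ.+ N)                              ≡⟨ cong (fib k) (ℕ.+-comm n N) ⟩
  fib k (N ℕ.+ n)                              ≡⟨ addition-formula {k} {fib k} (fib-recurrent k) N n ⟩
  fib k (suc n) * fib k N + fib k n * fibPrev k N ≈⟨ mod-+ (mod-*ˡ (fib k (suc n)) F≡0) (mod-*ˡ (fib k n) G≡s) ⟩
  fib k (suc n) * 0ℤ + fib k n * s             ≡⟨ simplify (fib k (suc n)) (fib k n) s ⟩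
  s * fib k n                                 ∎
  where
  open ModReasoning m
  simplify : ∀ x y s → x * 0ℤ + y * s ≡ s * y
  simplify = solve-∀

fibPrev≡1 : ∀ {k m N} → fib k N ≡ 0ℤ mod m → fib k (suc N) ≡ 1ℤ mod m → fibPrev k N ≡ 1ℤ mod m
fibPrev≡1 {k} {m} {N} F≡0 F′≡1 = begin
  fibPrev k N                               ≡⟨ isolate k (fibPrev k N) (fib k N) ⟩
  (k * fib k N + fibPrev k N) - k * fib k N ≡⟨ cong (_- k * fib k N) (fib-suc k N) ⟨
  fib k (suc N) - k * fib k N               ≈⟨ mod-- F′≡1 (mod-*ˡ k F≡0) ⟩
  1ℤ - k * 0ℤ                               ≡⟨ cong (_-_ 1ℤ) (ℤ.*-zeroʳ k) ⟩
  1ℤ                                        ∎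
  where
  open ModReasoning m
  isolate : ∀ k G F → G ≡ (k * F + G) - k * F
  isolate = solve-∀

period-intro : ∀ {k m N} → fib k N ≡ 0ℤ mod + m → fib k (suc N) ≡ 1ℤ mod + m → Period k m N
period-intro {k} {N = N} F≡0 F′≡1 n =
  mod-trans (fib-shift F≡0 (fibPrev≡1 {k} {N = N} F≡0 F′≡1) n) (≡⇒mod (ℤ.*-identityˡ (fib k n)))

antiperiod⇒period : ∀ {k m N} → fib k N ≡ 0ℤ mod + m → fibPrev k N ≡ -1ℤ mod + m → Period k m (2 ℕ.* N)
antiperiod⇒period {k} {m} {N} F≡0 G≡-1 n = begin
  fib k (n ℕ.+ 2 ℕ.* N)         ≡⟨ cong (fib k) reassoc ⟩
  fib k (n ℕ.+ N ℕ.+ N)         ≈⟨ fib-shift F≡0 G≡-1 (n ℕ.+ N) ⟩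
  -1ℤ * fib k (n ℕ.+ N)         ≈⟨ mod-*ˡ -1ℤ (fib-shift F≡0 G≡-1 n) ⟩
  -1ℤ * (-1ℤ * fib k n)         ≡⟨ sign² (fib k n) ⟩
  fib k n                       ∎
  where
  open ModReasoning (+ m)
  reassoc : n ℕ.+ 2 ℕ.* N ≡ n ℕ.+ N ℕ.+ N
  reassoc = trans (cong (λ x → n ℕ.+ (N ℕ.+ x)) (ℕ.+-identityʳ N)) (sym (ℕ.+-assoc n N N))
  sign² : ∀ x → -1ℤ * (-1ℤ * x) ≡ x
  sign² = solve-∀

module _ {K m N : ℕ} .{{_ : NonZero m}} where

  isPeriod⇒period : IsPeriod K m N → Period (+ K) m N
  isPeriod⇒period (_ , per) n = subst₂ (_≡_mod + m) (KFib≡fib K (n ℕ.+ N)) (KFib≡fib K n) (%≡%⇒mod (per n))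

  period⇒isPeriod : 0 ℕ.< N → Period (+ K) m N → IsPeriod K m N
  period⇒isPeriod 0<N per = 0<N , λ n →
    mod⇒%≡% (subst₂ (_≡_mod + m) (sym (KFib≡fib K (n ℕ.+ N))) (sym (KFib≡fib K n)) (per n))

period-minimal-∣ : ∀ {k m N T} .{{_ : NonZero N}} → Period k m N →
                   (∀ r → 0 ℕ.< r → r ℕ.< N → ¬ Period k m r) → Period k m T → N ∣ T
period-minimal-∣ {k} {m} {N} {T} per-N no-shorter per-T with T % N in T%N≡r
... | zero = ℕ∣.m%n≡0⇒n∣m T N T%N≡r
... | suc r = contradiction per-r (no-shorter (suc r) (ℕ.s≤s ℕ.z≤n) (subst (ℕ._< N) T%N≡r (m%n<n T N)))
  where
  per-r : Period k m (suc r)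
  per-r = subst (Period k m) T%N≡r
    (periodic-∸ (subst (Period k m) (m≡m%n+[m/n]*n T N) per-T) (periodic-* (T / N) per-N))

pisano-∣ : ∀ {K m N T} .{{_ : NonZero m}} → IsPisano K m N → Period (+ K) m T → N ∣ T
pisano-∣ {K} {m} {N} (isPeriod@(0<N , _) , least) =
  period-minimal-∣ {{ℕ.>-nonZero 0<N}} (isPeriod⇒period isPeriod)
    (λ r 0<r r<N per-r → ℕ.<⇒≱ r<N (least r (period⇒isPeriod 0<r per-r)))

odd-period⇒∣2 : ∀ {k m t} → Period k m (suc (2 ℕ.* t)) → m ∣ 2
odd-period⇒∣2 {k} {m} {t} per = ℤ∣.∣⇒∣ᵤ (≡0-mod⇒∣ 2≡0)
  where
  open ModReasoning (+ m)
  N : ℕ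
  N = suc (2 ℕ.* t)
  Fₙ₋₁≡1 : fib k (2 ℕ.* t) ≡ 1ℤ mod + m
  Fₙ₋₁≡1 = fibPrev≡1 {k} {N = N} (per 0) (per 1)
  even-sign : -1ℤ ^ (2 ℕ.* t) ≡ 1ℤ
  even-sign = trans (sym (ℤ.^-*-assoc -1ℤ 2 t)) (ℤ.^-zeroˡ t)
  2≡0 : + 2 ≡ 0ℤ mod + m
  2≡0 = begin
    + 2
      ≡⟨ cong (λ s → 1ℤ - - s) even-sign ⟨
    1ℤ - - (-1ℤ ^ (2 ℕ.* t))
      ≡⟨ cong (λ s → 1ℤ - s) (cassini k (2 ℕ.* t)) ⟨
    1ℤ - (fib k (suc N) * fib k (2 ℕ.* t) - fib k N * fib k N)
      ≈⟨ mod-+ˡ 1ℤ (mod-neg (mod-- (mod-* (per 1) Fₙ₋₁≡1) (mod-* (per 0) (per 0)))) ⟩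
    0ℤ ∎

-- Periods modulo prime powers and products

-- Δ solves the recurrence and vanishes modulo s, so by the addition formula it is T-periodic
-- modulo s²; telescoping then gives F(n + jT) ≡ F(n) + jΔ(n) (mod s²).
module Lift {k : ℤ} {s T : ℕ} (per : Period k s T) where

  s² : ℤ
  s² = + s * + s

  Δ : ℕ → ℤ
  Δ n = fib k (n ℕ.+ T) - fib k n

  Δ≡0 : ∀ n → Δ n ≡ 0ℤ mod + s
  Δ≡0 n = ∣⇒≡0-mod (∣difference (per n))

  Δ-recurrent : Recurrent k Δ
  Δ-recurrent n = regroup k (fib k (suc n ℕ.+ T)) (fib k (n ℕ.+ T)) (fib k (suc n)) (fib k n)
    where regroup : ∀ k a b c e → (k * a + b) - (k * c + e) ≡ k * (a - c) + (b - e)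
          regroup = solve-∀

  Δ-periodic : Periodic Δ s² T
  Δ-periodic n = begin
    Δ (n ℕ.+ T)                                             ≡⟨ cong Δ (ℕ.+-comm n T) ⟩
    Δ (T ℕ.+ n)                                             ≡⟨ addition-formula {k} {Δ} Δ-recurrent T n ⟩
    Δ (suc n) * fib k T + Δ n * fibPrev k T                 ≡⟨ split (Δ (suc n)) (Δ n) (fib k T) (fibPrev k T) ⟩
    (Δ (suc n) * fib k T + Δ n * (fibPrev k T - 1ℤ)) + Δ n  ≈⟨ mod-+ʳ (Δ n) (mod-+ (mod-*-zero (Δ≡0 (suc n)) (per 0))
                                                                                    (mod-*-zero (Δ≡0 n) G-1≡0)) ⟩
    0ℤ + Δ n                                                ≡⟨ ℤ.+-identityˡ (Δ n) ⟩
    Δ n                                                     ∎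
    where
    open ModReasoning s²
    split : ∀ x y F G → x * F + y * G ≡ (x * F + y * (G - 1ℤ)) + y
    split = solve-∀
    G-1≡0 : fibPrev k T - 1ℤ ≡ 0ℤ mod + s
    G-1≡0 = mod-- (fibPrev≡1 {k} {N = T} (per 0) (per 1)) (mod-refl {a = 1ℤ})

  fib-+-multiple : ∀ j n → fib k (n ℕ.+ j ℕ.* T) ≡ fib k n + + j * Δ n mod s²
  fib-+-multiple zero n = ≡⇒mod (trans (cong (fib k) (ℕ.+-identityʳ n)) (sym (vanish (fib k n) (Δ n))))
    where vanish : ∀ F D → F + 0ℤ * D ≡ F
          vanish = solve-∀
  fib-+-multiple (suc j) n = begin
    fib k (n ℕ.+ (T ℕ.+ j ℕ.* T))              ≡⟨ cong (fib k) reassoc ⟩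
    fib k (n ℕ.+ j ℕ.* T ℕ.+ T)                ≡⟨ difference (fib k (n ℕ.+ j ℕ.* T ℕ.+ T)) (fib k (n ℕ.+ j ℕ.* T)) ⟩
    fib k (n ℕ.+ j ℕ.* T) + Δ (n ℕ.+ j ℕ.* T)  ≈⟨ mod-+ (fib-+-multiple j n) (periodic-* j Δ-periodic n) ⟩
    (fib k n + + j * Δ n) + Δ n                ≡⟨ collect (fib k n) (+ j) (Δ n) ⟩
    fib k n + + suc j * Δ n                    ∎
    where
    open ModReasoning s²
    reassoc : n ℕ.+ (T ℕ.+ j ℕ.* T) ≡ n ℕ.+ j ℕ.* T ℕ.+ T
    reassoc = trans (cong (n ℕ.+_) (ℕ.+-comm T (j ℕ.* T))) (sym (ℕ.+-assoc n (j ℕ.* T) T))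
    difference : ∀ x y → x ≡ y + (x - y)
    difference = solve-∀
    collect : ∀ F J D → (F + J * D) + D ≡ F + (1ℤ + J) * D
    collect = solve-∀

period-lift : ∀ {k q s T} → q ∣ s → Period k s T → Period k (q ℕ.* s) (q ℕ.* T)
period-lift {k} {q} {s} {T} q∣s per n = begin
  fib k (n ℕ.+ q ℕ.* T) ≈⟨ mod-∣ qs∣s² (fib-+-multiple q n) ⟩
  fib k n + + q * Δ n   ≈⟨ mod-+ˡ (fib k n) qΔ≡0 ⟩
  fib k n + 0ℤ          ≡⟨ ℤ.+-identityʳ (fib k n) ⟩
  fib k n               ∎
  where
  open Lift per
  open ModReasoning (+ (q ℕ.* s))
  qs∣s² : + (q ℕ.* s) ℤ∣.∣ s²
  qs∣s² = subst (+ (q ℕ.* s) ℤ∣.∣_) (ℤ.pos-* s s) (ℤ∣.∣ᵤ⇒∣ (ℕ∣.*-monoˡ-∣ s q∣s))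
  qΔ≡0 : + q * Δ n ≡ 0ℤ mod + (q ℕ.* s)
  qΔ≡0 = subst (+ q * Δ n ≡ 0ℤ mod_) (sym (ℤ.pos-* q s)) (mod-*-zero {+ q} {+ s} mod-self (Δ≡0 n))

period-prime-power : ∀ {k p B} → Period k p B → ∀ f → Period k (p ℕ.^ suc f) (p ℕ.^ f ℕ.* B)
period-prime-power {k} {p} {B} per zero = subst₂ (Period k) (sym (ℕ.*-identityʳ p)) (sym (ℕ.*-identityˡ B)) per
period-prime-power {k} {p} {B} per (suc f) = subst (Period k (p ℕ.^ suc (suc f))) (sym (ℕ.*-assoc p (p ℕ.^ f) B))
  (period-lift {q = p} (ℕ∣.m∣m*n (p ℕ.^ f)) (period-prime-power per f))

period-product : ∀ {k L} qs → All Prime qs → All (λ q → Period k q L) qs → Period k (product qs) (product qs ℕ.* L)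
period-product [] All.[] All.[] n = mod-1
period-product {k} {L} (q ∷ qs) (q-prime All.∷ primes) (per-q All.∷ pers) with q ℕ∣.∣? product qs
... | yes q∣s = subst (Period k (q ℕ.* product qs)) (sym (ℕ.*-assoc q (product qs) L))
                  (period-lift q∣s (period-product qs primes pers))
... | no q∤s = periodic-crt (prime∤⇒coprime q-prime q∤s)
                 (periodic-∣ (ℕ∣.n∣m*n (q ℕ.* product qs)) per-q)
                 (periodic-∣ (subst (product qs ℕ.* L ∣_) (sym (ℕ.*-assoc q (product qs) L)) (ℕ∣.n∣m*n q))
                    (period-product qs primes pers))

module PrimeDivisors (n : ℕ) .{{_ : NonZero n}} where

  open PrimeFactorisation (factorise n) public using (factors; isFactorisation; factorsPrime)

  prime-divisors⇒all : ∀ {P : ℕ → Set} → (∀ q → Prime q → q ∣ n → P q) → All P factors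
  prime-divisors⇒all P-divisors = All.tabulate λ {q} q∈ →
    P-divisors q (All.lookup factorsPrime q∈) (subst (q ∣_) (sym isFactorisation) (∈⇒∣product q∈))

  all⇒prime-divisors : ∀ {P : ℕ → Set} → All P factors → ∀ q → Prime q → q ∣ n → P q
  all⇒prime-divisors P-factors q q-prime q∣n = All.lookup P-factors
    (factorisationHasAllPrimeFactors q-prime (subst (q ∣_) isFactorisation q∣n) factorsPrime)

period-from-prime-factors : ∀ {k n L} .{{_ : NonZero n}} →
                            (∀ q → Prime q → q ∣ n → Period k q L) → Period k n (n ℕ.* L)
period-from-prime-factors {k} {n} {L} per = subst (λ x → Period k x (x ℕ.* L)) (sym isFactorisation)
  (period-product factors factorsPrime (prime-divisors⇒all per))
  where open PrimeDivisors n

module _ {k : ℤ} {p c : ℕ} (p-prime : Prime p) where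

  cofactor-product : ∀ qs → All (λ q → ∃[ O ] p ∤ O × Period k q (c ℕ.* O)) qs →
                     ∃[ O ] p ∤ O × All (λ q → Period k q (c ℕ.* O)) qs
  cofactor-product [] All.[] = 1 , (λ p∣1 → ¬prime[1] (subst Prime (ℕ∣.∣1⇒≡1 p∣1) p-prime)) , All.[]
  cofactor-product (q ∷ qs) ((O , p∤O , per-q) All.∷ rest) with cofactor-product qs rest
  ... | O′ , p∤O′ , pers =
    O ℕ.* O′ ,
    [ p∤O , p∤O′ ]′ ∘ euclidsLemma O O′ p-prime ,
    periodic-∣ (ℕ∣.*-monoʳ-∣ c (ℕ∣.m∣m*n O′)) per-q All.∷ All.map (periodic-∣ (ℕ∣.*-monoʳ-∣ c (ℕ∣.n∣m*n O))) pers

common-cofactor : ∀ {k p c n} .{{_ : NonZero n}} → Prime p →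
                  (∀ q → Prime q → q ∣ n → ∃[ O ] p ∤ O × Period k q (c ℕ.* O)) →
                  ∃[ O ] p ∤ O × (∀ q → Prime q → q ∣ n → Period k q (c ℕ.* O))
common-cofactor {k} {p} {c} {n} p-prime per =
  let (O , p∤O , pers) = cofactor-product {k} {p} {c} p-prime factors (prime-divisors⇒all per)
  in O , p∤O , all⇒prime-divisors pers
  where open PrimeDivisors n

-- Moduli dividing all their periods

DividesPeriods : ℤ → ℕ → Set
DividesPeriods k m = ∀ T → Period k m T → m ∣ T

dividesPeriods⇒∣ : ∀ {k m p f r B O} → Prime p → DividesPeriods k m → m ≡ p ℕ.^ suc f ℕ.* r → p ∤ r →
                   Period k p B → Period k r (p ℕ.^ f ℕ.* O) → p ∣ B ℕ.* O
dividesPeriods⇒∣ {k} {m} {p} {f} {r} {B} {O} p-prime m∣periods refl p∤r per-p per-r =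
  ℕ∣.*-cancelˡ-∣ (p ℕ.^ f) {{ℕ.m^n≢0 p f {{prime⇒nonZero p-prime}}}} (ℕ∣.∣-trans pᶠp∣m (m∣periods T per-m))
  where
  T : ℕ
  T = p ℕ.^ f ℕ.* (B ℕ.* O)
  per-m : Period k m T
  per-m = periodic-crt (coprime-^ (prime∤⇒coprime p-prime p∤r) (suc f))
            (periodic-∣ (ℕ∣.*-monoʳ-∣ (p ℕ.^ f) (ℕ∣.m∣m*n O)) (period-prime-power per-p f))
            (periodic-∣ (ℕ∣.*-monoʳ-∣ (p ℕ.^ f) (ℕ∣.n∣m*n B)) per-r)
  pᶠp∣m : p ℕ.^ f ℕ.* p ∣ m
  pᶠp∣m = ℕ∣.∣-trans (ℕ∣.∣-reflexive (ℕ.*-comm (p ℕ.^ f) p)) (ℕ∣.m∣m*n r)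

prime-power-obstruction :
  ∀ {k m p e c B} .{{_ : NonZero m}} → Prime p → DividesPeriods k m →
  p ℕ.^ suc e ∣ m → c ∣ p ℕ.^ e → Period k p B → p ∤ B →
  (∀ q → Prime q → q ∣ m → q ≢ p → ∃[ O ] p ∤ O × Period k q (c ℕ.* O)) → ⊥
prime-power-obstruction {k} {m} {p} {e} {c} {B} p-prime m∣periods (divides m′ refl) c∣pᵉ per-p p∤B per-others
  with p-adic {p} {{prime⇒nonTrivial p-prime}} m′ {{ℕ.m*n≢0⇒m≢0 m′}}
... | j , r , refl , p∤r = conclude (common-cofactor {k} {p} {c} p-prime per-r-divisors)
  where
  instance
    r≢0 : NonZero r
    r≢0 = ℕ.m*n≢0⇒n≢0 (p ℕ.^ j) {{ℕ.m*n≢0⇒m≢0 (p ℕ.^ j ℕ.* r)}}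
  f : ℕ
  f = e ℕ.+ j

  per-r-divisors : ∀ q → Prime q → q ∣ r → ∃[ O ] p ∤ O × Period k q (c ℕ.* O)
  per-r-divisors q q-prime q∣r =
    per-others q q-prime (ℕ∣.∣-trans q∣r (ℕ∣.∣-trans (ℕ∣.n∣m*n (p ℕ.^ j)) (ℕ∣.m∣m*n (p ℕ.^ suc e))))
      λ { refl → p∤r q∣r }

  m≡ : p ℕ.^ j ℕ.* r ℕ.* p ℕ.^ suc e ≡ p ℕ.^ suc f ℕ.* r
  m≡ = trans (rearrange (p ℕ.^ j) r (p ℕ.^ suc e)) (cong (ℕ._* r) (sym (ℕ.^-distribˡ-+-* p (suc e) j)))
    where rearrange : ∀ x r y → x ℕ.* r ℕ.* y ≡ y ℕ.* x ℕ.* r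
          rearrange = ℕ-Solver.solve-∀

  c∣pᶠ : c ∣ p ℕ.^ f
  c∣pᶠ = ℕ∣.∣-trans c∣pᵉ (subst (p ℕ.^ e ∣_) (sym (ℕ.^-distribˡ-+-* p e j)) (ℕ∣.m∣m*n (p ℕ.^ j)))

  conclude : ∃[ O ] p ∤ O × (∀ q → Prime q → q ∣ r → Period k q (c ℕ.* O)) → ⊥
  conclude (O , p∤O , per-divisors) =
    [ p∤B , [ p∤r , p∤O ]′ ∘ euclidsLemma r O p-prime ]′
      (euclidsLemma B (r ℕ.* O) p-prime (dividesPeriods⇒∣ {f = f} p-prime m∣periods m≡ p∤r per-p per-r))
    where
    per-r : Period k r (p ℕ.^ f ℕ.* (r ℕ.* O))
    per-r = periodic-∣ (subst (_∣ p ℕ.^ f ℕ.* (r ℕ.* O)) (rearrange c r O) (ℕ∣.*-monoˡ-∣ (r ℕ.* O) c∣pᶠ))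
              (period-from-prime-factors per-divisors)
      where rearrange : ∀ c r O → c ℕ.* (r ℕ.* O) ≡ r ℕ.* (c ℕ.* O)
            rearrange = ℕ-Solver.solve-∀

-- Periods modulo primes

period-mod-2 : ∀ {k} → k ≡ 1ℤ mod + 2 → Period k 2 3
period-mod-2 k≡1 = period-cong (mod-sym k≡1) (period-intro {1ℤ} {N = 3} (%≡%⇒mod refl) (%≡%⇒mod refl))

period-mod-2-∣ : ∀ {k T} → k ≡ 1ℤ mod + 2 → Period k 2 T → 3 ∣ T
period-mod-2-∣ k≡1 per = period-minimal-∣ (period-mod-2 mod-refl) no-shorter (period-cong k≡1 per)
  where
  no-shorter : ∀ r → 0 ℕ.< r → r ℕ.< 3 → ¬ Period 1ℤ 2 r
  no-shorter 1 _ _ per = contradiction (mod⇒%≡% (per 0)) λ ()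
  no-shorter 2 _ _ per = contradiction (mod⇒%≡% (per 0)) λ ()
  no-shorter (suc (suc (suc r))) _ r<3 _ = ℕ.<⇒≱ r<3 (ℕ.m≤m+n 3 r)

period-mod-3 : ∀ {k} → k ≡ 1ℤ mod + 3 ⊎ k ≡ + 2 mod + 3 → Period k 3 8
period-mod-3 (inj₁ k≡1) = period-cong (mod-sym k≡1) (period-intro {1ℤ} {N = 8} (%≡%⇒mod refl) (%≡%⇒mod refl))
period-mod-3 (inj₂ k≡2) = period-cong (mod-sym k≡2) (period-intro {+ 2} {N = 8} (%≡%⇒mod refl) (%≡%⇒mod refl))

period-mod-3-∣ : ∀ {k T} → k ≡ 1ℤ mod + 3 ⊎ k ≡ + 2 mod + 3 → Period k 3 T → 8 ∣ T
period-mod-3-∣ (inj₁ k≡1) per = period-minimal-∣ (period-mod-3 (inj₁ mod-refl)) no-shorter (period-cong k≡1 per)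
  where
  no-shorter : ∀ r → 0 ℕ.< r → r ℕ.< 8 → ¬ Period 1ℤ 3 r
  no-shorter 1 _ _ per = contradiction (mod⇒%≡% (per 0)) λ ()
  no-shorter 2 _ _ per = contradiction (mod⇒%≡% (per 0)) λ ()
  no-shorter 3 _ _ per = contradiction (mod⇒%≡% (per 0)) λ ()
  no-shorter 4 _ _ per = contradiction (mod⇒%≡% (per 1)) λ ()
  no-shorter 5 _ _ per = contradiction (mod⇒%≡% (per 0)) λ ()
  no-shorter 6 _ _ per = contradiction (mod⇒%≡% (per 0)) λ ()
  no-shorter 7 _ _ per = contradiction (mod⇒%≡% (per 0)) λ ()
  no-shorter (suc (suc (suc (suc (suc (suc (suc (suc r)))))))) _ r<8 _ = ℕ.<⇒≱ r<8 (ℕ.m≤m+n 8 r)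
period-mod-3-∣ (inj₂ k≡2) per = period-minimal-∣ (period-mod-3 (inj₂ mod-refl)) no-shorter (period-cong k≡2 per)
  where
  no-shorter : ∀ r → 0 ℕ.< r → r ℕ.< 8 → ¬ Period (+ 2) 3 r
  no-shorter 1 _ _ per = contradiction (mod⇒%≡% (per 0)) λ ()
  no-shorter 2 _ _ per = contradiction (mod⇒%≡% (per 0)) λ ()
  no-shorter 3 _ _ per = contradiction (mod⇒%≡% (per 0)) λ ()
  no-shorter 4 _ _ per = contradiction (mod⇒%≡% (per 1)) λ ()
  no-shorter 5 _ _ per = contradiction (mod⇒%≡% (per 0)) λ ()
  no-shorter 6 _ _ per = contradiction (mod⇒%≡% (per 0)) λ ()
  no-shorter 7 _ _ per = contradiction (mod⇒%≡% (per 0)) λ ()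
  no-shorter (suc (suc (suc (suc (suc (suc (suc (suc r)))))))) _ r<8 _ = ℕ.<⇒≱ r<8 (ℕ.m≤m+n 8 r)

two-inverse : ∀ r → + 2 * + suc r ≡ 1ℤ mod + suc (2 ℕ.* r)
two-inverse r = mod-trans (≡⇒mod (trans (double (+ r)) (cong (λ x → 1ℤ + (1ℤ + x)) (sym (ℤ.pos-* 2 r)))))
                          (mod-+ˡ 1ℤ (mod-self {+ suc (2 ℕ.* r)}))
  where double : ∀ r → + 2 * (1ℤ + r) ≡ 1ℤ + (1ℤ + + 2 * r)
        double = solve-∀

-- Modulo q, x² - kx - 1 = (x - c)² with 2c ≡ k and c² ≡ -1, so F(n) ≡ n c^(n-1) = n c^(n+3).
module _ {k : ℤ} {q h : ℕ} (2h≡1 : + 2 * + h ≡ 1ℤ mod + q) (q∣D : k * k + + 4 ≡ 0ℤ mod + q) where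

  private
    c : ℤ
    c = k * + h

    2c≡k : + 2 * c ≡ k mod + q
    2c≡k = begin
      + 2 * (k * + h)   ≡⟨ swap k (+ h) ⟩
      k * (+ 2 * + h)   ≈⟨ mod-*ˡ k 2h≡1 ⟩
      k * 1ℤ            ≡⟨ ℤ.*-identityʳ k ⟩
      k                 ∎
      where
      open ModReasoning (+ q)
      swap : ∀ k h → + 2 * (k * h) ≡ k * (+ 2 * h)
      swap = solve-∀

    c²≡-1 : c * c ≡ -1ℤ mod + q
    c²≡-1 = begin
      (k * + h) * (k * + h)                                   ≡⟨ expand k (+ h) ⟩
      (k * k + + 4) * (+ h * + h) - (+ 2 * + h) * (+ 2 * + h) ≈⟨ mod-- (mod-*ʳ (+ h * + h) q∣D) (mod-* 2h≡1 2h≡1) ⟩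
      0ℤ * (+ h * + h) - 1ℤ * 1ℤ                              ≡⟨ cong (_- 1ℤ) (ℤ.*-zeroˡ (+ h * + h)) ⟩
      -1ℤ                                                     ∎
      where
      open ModReasoning (+ q)
      expand : ∀ k h → (k * h) * (k * h) ≡ (k * k + + 4) * (h * h) - (+ 2 * h) * (+ 2 * h)
      expand = solve-∀

    c⁴≡1 : c ^ 4 ≡ 1ℤ mod + q
    c⁴≡1 = mod-trans (≡⇒mod (fourth c)) (mod-* c²≡-1 c²≡-1)
      where fourth : ∀ c → c * (c * (c * (c * 1ℤ))) ≡ (c * c) * (c * c)
            fourth = solve-∀

    fib≡n*c^[n+3] : ∀ n → fib k n ≡ + n * c ^ (n ℕ.+ 3) mod + q
    fib≡n*c^[n+3] zero = ≡⇒mod (sym (ℤ.*-zeroˡ (c ^ 3)))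
    fib≡n*c^[n+3] (suc zero) = mod-sym (mod-trans (≡⇒mod (ℤ.*-identityˡ (c ^ 4))) c⁴≡1)
    fib≡n*c^[n+3] (suc (suc n)) = begin
      k * fib k (suc n) + fib k n
        ≈⟨ mod-+ (mod-*ˡ k (fib≡n*c^[n+3] (suc n))) (fib≡n*c^[n+3] n) ⟩
      k * (+ suc n * (c * X)) + + n * X
        ≈⟨ mod-+ʳ (+ n * X) (mod-*ʳ (+ suc n * (c * X)) 2c≡k) ⟨
      (+ 2 * c) * (+ suc n * (c * X)) + + n * X
        ≡⟨ regroup c (+ n) X ⟩
      + suc (suc n) * (c * (c * X)) + (+ n * X) * (c * c + 1ℤ)
        ≈⟨ mod-+ˡ (+ suc (suc n) * (c * (c * X))) (mod-*ˡ (+ n * X) (mod-+ʳ 1ℤ c²≡-1)) ⟩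
      + suc (suc n) * (c * (c * X)) + (+ n * X) * 0ℤ
        ≡⟨ vanish (+ suc (suc n) * (c * (c * X))) (+ n * X) ⟩
      + suc (suc n) * (c * (c * X)) ∎
      where
      open ModReasoning (+ q)
      X : ℤ
      X = c ^ (n ℕ.+ 3)
      regroup : ∀ c N X → (+ 2 * c) * ((1ℤ + N) * (c * X)) + N * X
                          ≡ (+ 2 + N) * (c * (c * X)) + (N * X) * (c * c + 1ℤ)
      regroup = solve-∀
      vanish : ∀ a b → a + b * 0ℤ ≡ a
      vanish = solve-∀

  period-of-discriminant-divisor : Period k q (4 ℕ.* q)
  period-of-discriminant-divisor = period-intro {k} {N = 4 ℕ.* q} F₄q≡0 F₄q₊₁≡1
    where
    open ModReasoning (+ q)
    4q≡0 : + (4 ℕ.* q) ≡ 0ℤ mod + q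
    4q≡0 = ∣⇒≡0-mod-ℕ (ℕ∣.n∣m*n 4)
    F₄q≡0 : fib k (4 ℕ.* q) ≡ 0ℤ mod + q
    F₄q≡0 = begin
      fib k (4 ℕ.* q)                           ≈⟨ fib≡n*c^[n+3] (4 ℕ.* q) ⟩
      + (4 ℕ.* q) * c ^ (4 ℕ.* q ℕ.+ 3)         ≈⟨ mod-*ʳ (c ^ (4 ℕ.* q ℕ.+ 3)) 4q≡0 ⟩
      0ℤ * c ^ (4 ℕ.* q ℕ.+ 3)                  ≡⟨ ℤ.*-zeroˡ (c ^ (4 ℕ.* q ℕ.+ 3)) ⟩
      0ℤ                                        ∎
    F₄q₊₁≡1 : fib k (suc (4 ℕ.* q)) ≡ 1ℤ mod + q
    F₄q₊₁≡1 = begin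
      fib k (suc (4 ℕ.* q))                      ≈⟨ fib≡n*c^[n+3] (suc (4 ℕ.* q)) ⟩
      (1ℤ + + (4 ℕ.* q)) * c ^ (suc (4 ℕ.* q) ℕ.+ 3) ≡⟨ cong (λ e → (1ℤ + + (4 ℕ.* q)) * c ^ e) (exponent q) ⟩
      (1ℤ + + (4 ℕ.* q)) * c ^ (4 ℕ.* suc q)    ≡⟨ cong ((1ℤ + + (4 ℕ.* q)) *_) (sym (ℤ.^-*-assoc c 4 (suc q))) ⟩
      (1ℤ + + (4 ℕ.* q)) * (c ^ 4) ^ suc q      ≈⟨ mod-* (mod-+ˡ 1ℤ 4q≡0) (mod-^ (suc q) c⁴≡1) ⟩
      1ℤ * 1ℤ ^ suc q                           ≡⟨ ℤ.^-zeroˡ (suc (suc q)) ⟩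
      1ℤ                                        ∎
      where exponent : ∀ q → suc (4 ℕ.* q) ℕ.+ 3 ≡ 4 ℕ.* suc q
            exponent = ℕ-Solver.solve-∀

-- ℤ[α]/(n) with α² = kα + 1: the pair (a , b) stands for a + bα.
module QuadraticRing (k : ℤ) (n : ℕ) where

  infix 4 _≈_
  infixl 6 _⊕_
  infixl 7 _⊗_

  record _≈_ (x y : ℤ × ℤ) : Set where
    constructor _,_
    field
      first  : proj₁ x ≡ proj₁ y mod + n
      second : proj₂ x ≡ proj₂ y mod + n

  _⊕_ : ℤ × ℤ → ℤ × ℤ → ℤ × ℤ
  (a , b) ⊕ (c , d) = a + c , b + d

  _⊗_ : ℤ × ℤ → ℤ × ℤ → ℤ × ℤ
  (a , b) ⊗ (c , d) = a * c + b * d , a * d + b * c + k * (b * d)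

  𝟘 𝟙 α : ℤ × ℤ
  𝟘 = 0ℤ , 0ℤ
  𝟙 = 1ℤ , 0ℤ
  α = 0ℤ , 1ℤ

  private
    exact : ∀ {x y} → proj₁ x ≡ proj₁ y → proj₂ x ≡ proj₂ y → x ≈ y
    exact e₁ e₂ = ≡⇒mod e₁ , ≡⇒mod e₂

  ≈-refl : ∀ {x} → x ≈ x
  ≈-refl = mod-refl , mod-refl

  ≈-isEquivalence : IsEquivalence _≈_
  ≈-isEquivalence = record
    { refl = ≈-refl
    ; sym = λ (e₁ , e₂) → mod-sym e₁ , mod-sym e₂
    ; trans = λ (e₁ , e₂) (f₁ , f₂) → mod-trans e₁ f₁ , mod-trans e₂ f₂
    }


  ⊕-cong : ∀ {x y u v} → x ≈ y → u ≈ v → x ⊕ u ≈ y ⊕ v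
  ⊕-cong (e₁ , e₂) (f₁ , f₂) = mod-+ e₁ f₁ , mod-+ e₂ f₂

  ⊗-cong : ∀ {x y u v} → x ≈ y → u ≈ v → x ⊗ u ≈ y ⊗ v
  ⊗-cong (e₁ , e₂) (f₁ , f₂) = mod-+ (mod-* e₁ f₁) (mod-* e₂ f₂) ,
                               mod-+ (mod-+ (mod-* e₁ f₂) (mod-* e₂ f₁)) (mod-*ˡ k (mod-* e₂ f₂))

  ⊗-congˡ : ∀ x {u v} → u ≈ v → x ⊗ u ≈ x ⊗ v
  ⊗-congˡ x = ⊗-cong {x} {x} ≈-refl

  ⊕-assoc : ∀ x y z → (x ⊕ y) ⊕ z ≈ x ⊕ (y ⊕ z)
  ⊕-assoc (a , b) (c , d) (e , f) = exact (ℤ.+-assoc a c e) (ℤ.+-assoc b d f)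

  ⊕-comm : ∀ x y → x ⊕ y ≈ y ⊕ x
  ⊕-comm (a , b) (c , d) = exact (ℤ.+-comm a c) (ℤ.+-comm b d)

  ⊕-identityˡ : ∀ x → 𝟘 ⊕ x ≈ x
  ⊕-identityˡ (a , b) = exact (ℤ.+-identityˡ a) (ℤ.+-identityˡ b)

  ⊗-assoc : ∀ x y z → (x ⊗ y) ⊗ z ≈ x ⊗ (y ⊗ z)
  ⊗-assoc (a , b) (c , d) (e , f) = exact (assoc₁ k a b c d e f) (assoc₂ k a b c d e f)
    where
    assoc₁ : ∀ k a b c d e f → (a * c + b * d) * e + (a * d + b * c + k * (b * d)) * f
                              ≡ a * (c * e + d * f) + b * (c * f + d * e + k * (d * f))
    assoc₁ = solve-∀
    assoc₂ : ∀ k a b c d e f → (a * c + b * d) * f + (a * d + b * c + k * (b * d)) * e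
                                 + k * ((a * d + b * c + k * (b * d)) * f)
                              ≡ a * (c * f + d * e + k * (d * f)) + b * (c * e + d * f)
                                 + k * (b * (c * f + d * e + k * (d * f)))
    assoc₂ = solve-∀

  ⊗-comm : ∀ x y → x ⊗ y ≈ y ⊗ x
  ⊗-comm (a , b) (c , d) = exact (comm₁ a b c d) (comm₂ k a b c d)
    where
    comm₁ : ∀ a b c d → a * c + b * d ≡ c * a + d * b
    comm₁ = solve-∀
    comm₂ : ∀ k a b c d → a * d + b * c + k * (b * d) ≡ c * b + d * a + k * (d * b)
    comm₂ = solve-∀

  ⊗-identityˡ : ∀ x → 𝟙 ⊗ x ≈ x
  ⊗-identityˡ (a , b) = exact (identity₁ a b) (identity₂ k a b)
    where
    identity₁ : ∀ a b → 1ℤ * a + 0ℤ * b ≡ a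
    identity₁ = solve-∀
    identity₂ : ∀ k a b → 1ℤ * b + 0ℤ * a + k * (0ℤ * b) ≡ b
    identity₂ = solve-∀

  ⊗-distribʳ : ∀ x y z → (y ⊕ z) ⊗ x ≈ y ⊗ x ⊕ z ⊗ x
  ⊗-distribʳ (a , b) (c , d) (e , f) = exact (distrib₁ a b c d e f) (distrib₂ k a b c d e f)
    where
    distrib₁ : ∀ a b c d e f → (c + e) * a + (d + f) * b ≡ (c * a + d * b) + (e * a + f * b)
    distrib₁ = solve-∀
    distrib₂ : ∀ k a b c d e f → (c + e) * b + (d + f) * a + k * ((d + f) * b)
                                ≡ (c * b + d * a + k * (d * b)) + (e * b + f * a + k * (f * b))
    distrib₂ = solve-∀

  ⊗-zeroˡ : ∀ x → 𝟘 ⊗ x ≈ 𝟘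
  ⊗-zeroˡ (a , b) = exact (zero₁ a b) (zero₂ k a b)
    where
    zero₁ : ∀ a b → 0ℤ * a + 0ℤ * b ≡ 0ℤ
    zero₁ = solve-∀
    zero₂ : ∀ k a b → 0ℤ * b + 0ℤ * a + k * (0ℤ * b) ≡ 0ℤ
    zero₂ = solve-∀

  commutativeSemiring : CommutativeSemiring 0ℓ 0ℓ
  commutativeSemiring = record
    { Carrier = ℤ × ℤ
    ; _≈_ = _≈_
    ; _+_ = _⊕_
    ; _*_ = _⊗_
    ; 0# = 𝟘
    ; 1# = 𝟙
    ; isCommutativeSemiring = isCommutativeSemiringˡ record
      { +-isCommutativeMonoid = isCommutativeMonoidˡ record
        { isSemigroup = record
          { isMagma = record { isEquivalence = ≈-isEquivalence ; ∙-cong = ⊕-cong }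
          ; assoc = ⊕-assoc
          }
        ; identityˡ = ⊕-identityˡ
        ; comm = ⊕-comm
        }
      ; *-isCommutativeMonoid = isCommutativeMonoidˡ record
        { isSemigroup = record
          { isMagma = record { isEquivalence = ≈-isEquivalence ; ∙-cong = ⊗-cong }
          ; assoc = ⊗-assoc
          }
        ; identityˡ = ⊗-identityˡ
        ; comm = ⊗-comm
        }
      ; distribʳ = ⊗-distribʳ
      ; zeroˡ = ⊗-zeroˡ
      }
    }
    where open Algebra.Structures.Biased _≈_ using (isCommutativeSemiringˡ; isCommutativeMonoidˡ)

  open CommutativeSemiring commutativeSemiring using (setoid; semiring; +-monoid)
  open import Algebra.Properties.Semiring.Exp semiring public using () renaming (_^_ to _⊗^_)
  open import Algebra.Properties.Monoid.Mult +-monoid public using () renaming (_×_ to _·_)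
  open SetoidReasoning setoid

  ι : ℤ → ℤ × ℤ
  ι c = c , 0ℤ

  ι-cong : ∀ {a b} → a ≡ b mod + n → ι a ≈ ι b
  ι-cong a≡b = a≡b , mod-refl

  ι-⊗ : ∀ c a b → ι c ⊗ (a , b) ≈ (c * a , c * b)
  ι-⊗ c a b = exact (scale₁ c a b) (scale₂ k c a b)
    where
    scale₁ : ∀ c a b → c * a + 0ℤ * b ≡ c * a
    scale₁ = solve-∀
    scale₂ : ∀ k c a b → c * b + 0ℤ * a + k * (0ℤ * b) ≡ c * b
    scale₂ = solve-∀

  ι-⊗^ : ∀ c n → ι c ⊗^ n ≈ ι (c ^ n)
  ι-⊗^ c zero    = ≈-refl
  ι-⊗^ c (suc n) = begin
    ι c ⊗ ι c ⊗^ n       ≈⟨ ⊗-congˡ (ι c) (ι-⊗^ c n) ⟩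
    ι c ⊗ ι (c ^ n)      ≈⟨ ι-⊗ c (c ^ n) 0ℤ ⟩
    (c * c ^ n , c * 0ℤ) ≈⟨ exact refl (ℤ.*-zeroʳ c) ⟩
    ι (c ^ suc n)        ∎

  ·𝟙≈ι : ∀ n → n · 𝟙 ≈ ι (+ n)
  ·𝟙≈ι zero    = ≈-refl
  ·𝟙≈ι (suc n) = ⊕-cong {𝟙} {𝟙} ≈-refl (·𝟙≈ι n)

  α⊗^ : ∀ n → α ⊗^ n ≈ (fibPrev k n , fib k n)
  α⊗^ zero    = ≈-refl
  α⊗^ (suc n) = begin
    α ⊗ α ⊗^ n                  ≈⟨ ⊗-congˡ α (α⊗^ n) ⟩
    α ⊗ (fibPrev k n , fib k n) ≈⟨ exact (shift₁ G F) (trans (shift₂ k G F) (sym (fib-suc k n))) ⟩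
    (fib k n , fib k (suc n))   ∎
    where
    G F : ℤ
    G = fibPrev k n
    F = fib k n
    shift₁ : ∀ G F → 0ℤ * G + 1ℤ * F ≡ F
    shift₁ = solve-∀
    shift₂ : ∀ k G F → 0ℤ * F + 1ℤ * G + k * (1ℤ * F) ≡ k * F + G
    shift₂ = solve-∀

  β : ℤ × ℤ
  β = - k , + 2

  β⊗β : β ⊗ β ≈ ι (k * k + + 4)
  β⊗β = exact (square₁ k) (square₂ k)
    where
    square₁ : ∀ k → - k * - k + + 2 * + 2 ≡ k * k + + 4
    square₁ = solve-∀
    square₂ : ∀ k → - k * + 2 + + 2 * - k + k * (+ 2 * + 2) ≡ 0ℤ
    square₂ = solve-∀

  ·-scale : ∀ j x → j · x ≈ (+ j * proj₁ x , + j * proj₂ x)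
  ·-scale zero    (a , b) = exact (sym (ℤ.*-zeroˡ a)) (sym (ℤ.*-zeroˡ b))
  ·-scale (suc j) (a , b) = begin
    (a , b) ⊕ j · (a , b)                ≈⟨ ⊕-cong {a , b} {a , b} ≈-refl (·-scale j (a , b)) ⟩
    (a + + j * a , b + + j * b)          ≈⟨ exact (successor (+ j) a) (successor (+ j) b) ⟩
    (+ suc j * a , + suc j * b)          ∎
    where successor : ∀ J a → a + J * a ≡ (1ℤ + J) * a
          successor = solve-∀

  characteristic : ∀ x → n · x ≈ 𝟘
  characteristic (a , b) with ·-scale n (a , b)
  ... | scale₁ , scale₂ = mod-trans scale₁ (multiple a) , mod-trans scale₂ (multiple b)
    where
    multiple : ∀ a → + n * a ≡ 0ℤ mod + n
    multiple a = mod-trans (≡⇒mod (ℤ.*-comm (+ n) a)) (mod-multiple a)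

-- With β = 2α - k one has β² = D, so β^p = ε β for ε = D^r ≡ ±1. Frobenius applied to
-- 2α = β + k, together with α^p = F(p-1) + F(p) α, gives 2F(p) ≡ 2ε and 2F(p-1) ≡ k - εk.
module DiscriminantNonDivisor (K r : ℕ) (p-prime : Prime (suc (2 ℕ.* r))) (p∤D : suc (2 ℕ.* r) ∤ K ℕ.* K ℕ.+ 4) where

  p : ℕ
  p = suc (2 ℕ.* r)
  k D ε : ℤ
  k = + K
  D = + (K ℕ.* K ℕ.+ 4)
  ε = D ^ r

  k²+4≡D : k * k + + 4 ≡ D
  k²+4≡D = sym (trans (ℤ.pos-+ (K ℕ.* K) 4) (cong (_+ + 4) (ℤ.pos-* K K)))

  open QuadraticRing k p
  open CommutativeSemiring commutativeSemiring
    using (setoid; semiring; *-identityʳ) renaming (sym to ≈-sym; trans to ≈-trans)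
  open Characteristic commutativeSemiring p-prime using (frobenius; fermat)
  open import Algebra.Properties.Semiring.Exp semiring using (^-congˡ; ^-assocʳ)
  open import Algebra.Properties.CommutativeSemiring.Exp commutativeSemiring using (^-distrib-*)

  fermat-ι : ∀ a → ι (+ a) ⊗^ p ≈ ι (+ a)
  fermat-ι a = begin
    ι (+ a) ⊗^ p ≈⟨ ^-congˡ p (≈-sym (·𝟙≈ι a)) ⟩
    (a · 𝟙) ⊗^ p ≈⟨ fermat characteristic a ⟩
    a · 𝟙        ≈⟨ ·𝟙≈ι a ⟩
    ι (+ a)      ∎
    where open SetoidReasoning setoid

  fermat-ℤ : ∀ a → (+ a) ^ p ≡ + a mod + p
  fermat-ℤ a = _≈_.first (≈-trans (≈-sym (ι-⊗^ (+ a) p)) (fermat-ι a))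

  ε² : ε * ε ≡ 1ℤ mod + p
  ε² = mod-cancelˡ p-prime p∤D (begin
    D * (ε * ε)       ≡⟨ cong (D *_) (sym (ℤ.^-distribˡ-+-* D r r)) ⟩
    D * D ^ (r ℕ.+ r) ≡⟨ cong (λ e → D * D ^ (r ℕ.+ e)) (sym (ℕ.+-identityʳ r)) ⟩
    D ^ p             ≈⟨ fermat-ℤ (K ℕ.* K ℕ.+ 4) ⟩
    D                 ≡⟨ ℤ.*-identityʳ D ⟨
    D * 1ℤ            ∎)
    where open ModReasoning (+ p)

  ε²-1≡0 : (ε - 1ℤ) * (ε + 1ℤ) ≡ 0ℤ mod + p
  ε²-1≡0 = mod-trans {b = ε * ε - 1ℤ} (≡⇒mod (difference-of-squares ε)) (mod-- ε² (mod-refl {a = 1ℤ}))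
    where difference-of-squares : ∀ e → (e - 1ℤ) * (e + 1ℤ) ≡ e * e - 1ℤ
          difference-of-squares = solve-∀

  ε≡±1 : ε ≡ 1ℤ mod + p ⊎ ε ≡ -1ℤ mod + p
  ε≡±1 = Sum.map difference≡0⇒mod difference≡0⇒mod (mod-euclid {a = ε - 1ℤ} {b = ε + 1ℤ} p-prime ε²-1≡0)

  β⊗^p : β ⊗^ p ≈ ι ε ⊗ β
  β⊗^p = begin
    β ⊗ β ⊗^ (2 ℕ.* r)    ≈⟨ ⊗-congˡ β (^-assocʳ β 2 r) ⟨
    β ⊗ (β ⊗^ 2) ⊗^ r     ≈⟨ ⊗-congˡ β (^-congˡ r (⊗-congˡ β (*-identityʳ β))) ⟩
    β ⊗ (β ⊗ β) ⊗^ r      ≈⟨ ⊗-congˡ β (^-congˡ r (≈-trans β⊗β (ι-cong (≡⇒mod k²+4≡D)))) ⟩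
    β ⊗ ι D ⊗^ r          ≈⟨ ⊗-congˡ β (ι-⊗^ D r) ⟩
    β ⊗ ι ε               ≈⟨ ⊗-comm β (ι ε) ⟩
    ι ε ⊗ β               ∎
    where open SetoidReasoning setoid

  2α≈β+k : ι (+ 2) ⊗ α ≈ β ⊕ ι k
  2α≈β+k = ≡⇒mod (coefficient₁ k) , ≡⇒mod (coefficient₂ k)
    where
    coefficient₁ : ∀ k → + 2 * 0ℤ + 0ℤ * 1ℤ ≡ - k + k
    coefficient₁ = solve-∀
    coefficient₂ : ∀ k → + 2 * 1ℤ + 0ℤ * 0ℤ + k * (0ℤ * 1ℤ) ≡ + 2 + 0ℤ
    coefficient₂ = solve-∀

  frobenius-fib : (+ 2 * fib k (2 ℕ.* r) , + 2 * fib k p) ≈ (ε * - k + k , ε * + 2 + 0ℤ)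
  frobenius-fib = begin
    (+ 2 * fib k (2 ℕ.* r) , + 2 * fib k p) ≈⟨ ι-⊗ (+ 2) _ _ ⟨
    ι (+ 2) ⊗ (fib k (2 ℕ.* r) , fib k p)   ≈⟨ ⊗-congˡ (ι (+ 2)) (α⊗^ p) ⟨
    ι (+ 2) ⊗ α ⊗^ p                        ≈⟨ ⊗-cong (fermat-ι 2) ≈-refl ⟨
    ι (+ 2) ⊗^ p ⊗ α ⊗^ p                   ≈⟨ ^-distrib-* (ι (+ 2)) α p ⟨
    (ι (+ 2) ⊗ α) ⊗^ p                      ≈⟨ ^-congˡ p 2α≈β+k ⟩
    (β ⊕ ι k) ⊗^ p                          ≈⟨ frobenius characteristic β (ι k) ⟩
    β ⊗^ p ⊕ ι k ⊗^ p                       ≈⟨ ⊕-cong β⊗^p (fermat-ι K) ⟩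
    ι ε ⊗ β ⊕ ι k                           ≈⟨ ⊕-cong (ι-⊗ ε (- k) (+ 2)) ≈-refl ⟩
    (ε * - k + k , ε * + 2 + 0ℤ)            ∎
    where open SetoidReasoning setoid


  p∤2 : p ∤ 2
  p∤2 = ℕ∣.>⇒∤ (ℕ.≤∧≢⇒< (ℕ.nonTrivial⇒n>1 p {{prime⇒nonTrivial p-prime}}) λ 2≡p → ℕ.even≢odd 1 r 2≡p)

  halve : ∀ {x y} → + 2 * x ≡ + 2 * y mod + p → x ≡ y mod + p
  halve = mod-cancelˡ p-prime p∤2

  F₂ᵣ≡ : + 2 * fib k (2 ℕ.* r) ≡ ε * - k + k mod + p
  F₂ᵣ≡ = _≈_.first frobenius-fib

  Fₚ≡ : + 2 * fib k p ≡ ε * + 2 + 0ℤ mod + p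
  Fₚ≡ = _≈_.second frobenius-fib

  period-of-ε≡1 : ε ≡ 1ℤ mod + p → Period k p (2 ℕ.* r)
  period-of-ε≡1 ε≡1 = period-intro {k} {N = 2 ℕ.* r} F₂ᵣ≡0 Fₚ≡1
    where
    open ModReasoning (+ p)
    F₂ᵣ≡0 : fib k (2 ℕ.* r) ≡ 0ℤ mod + p
    F₂ᵣ≡0 = halve (begin
      + 2 * fib k (2 ℕ.* r) ≈⟨ F₂ᵣ≡ ⟩
      ε * - k + k            ≈⟨ mod-+ʳ k (mod-*ʳ (- k) ε≡1) ⟩
      1ℤ * - k + k           ≡⟨ cancel k ⟩
      + 2 * 0ℤ               ∎)
      where cancel : ∀ k → 1ℤ * - k + k ≡ + 2 * 0ℤ
            cancel = solve-∀
    Fₚ≡1 : fib k p ≡ 1ℤ mod + p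
    Fₚ≡1 = halve (begin
      + 2 * fib k p  ≈⟨ Fₚ≡ ⟩
      ε * + 2 + 0ℤ   ≈⟨ mod-+ʳ 0ℤ (mod-*ʳ (+ 2) ε≡1) ⟩
      + 2 * 1ℤ       ∎)

  period-of-ε≡-1 : ε ≡ -1ℤ mod + p → Period k p (2 ℕ.* suc p)
  period-of-ε≡-1 ε≡-1 = antiperiod⇒period {k} {N = suc p} Fₚ₊₁≡0 Fₚ≡-1
    where
    open ModReasoning (+ p)
    Fₚ≡-1 : fib k p ≡ -1ℤ mod + p
    Fₚ≡-1 = halve (begin
      + 2 * fib k p  ≈⟨ Fₚ≡ ⟩
      ε * + 2 + 0ℤ   ≈⟨ mod-+ʳ 0ℤ (mod-*ʳ (+ 2) ε≡-1) ⟩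
      + 2 * -1ℤ      ∎)
    F₂ᵣ≡k : fib k (2 ℕ.* r) ≡ k mod + p
    F₂ᵣ≡k = halve (begin
      + 2 * fib k (2 ℕ.* r) ≈⟨ F₂ᵣ≡ ⟩
      ε * - k + k            ≈⟨ mod-+ʳ k (mod-*ʳ (- k) ε≡-1) ⟩
      -1ℤ * - k + k          ≡⟨ double k ⟩
      + 2 * k                ∎)
      where double : ∀ k → -1ℤ * - k + k ≡ + 2 * k
            double = solve-∀
    Fₚ₊₁≡0 : fib k (suc p) ≡ 0ℤ mod + p
    Fₚ₊₁≡0 = begin
      k * fib k p + fib k (2 ℕ.* r) ≈⟨ mod-+ (mod-*ˡ k Fₚ≡-1) F₂ᵣ≡k ⟩
      k * -1ℤ + k                   ≡⟨ cancel k ⟩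
      0ℤ                            ∎
      where cancel : ∀ k → k * -1ℤ + k ≡ 0ℤ
            cancel = solve-∀

  period : Period k p (2 ℕ.* r) ⊎ Period k p (2 ℕ.* suc p)
  period = Sum.map period-of-ε≡1 period-of-ε≡-1 ε≡±1

period-of-discriminant-non-divisor :
  ∀ K {q} → Prime q → q ≢ 2 → q ∤ K ℕ.* K ℕ.+ 4 →
  ∃[ B ] Period (+ K) q B × (∀ p → Prime p → p ≢ 2 → q ℕ.≤ p → p ∤ B)
period-of-discriminant-non-divisor K q-prime q≢2 q∤D with odd-prime q-prime q≢2
... | r , refl = [ (λ per → 2 ℕ.* r , per , p∤2r) , (λ per → 2 ℕ.* suc q , per , p∤2[q+1]) ]′
                   (DiscriminantNonDivisor.period K r q-prime q∤D)
  where
  q : ℕ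
  q = suc (2 ℕ.* r)
  2r≢0 : NonZero (2 ℕ.* r)
  2r≢0 = ℕ.≢-nonZero λ 2r≡0 → ¬prime[1] (subst (λ n → Prime (suc n)) 2r≡0 q-prime)
  p∤2r : ∀ p → Prime p → p ≢ 2 → q ℕ.≤ p → p ∤ 2 ℕ.* r
  p∤2r _ _ _ q≤p = ℕ∣.>⇒∤ {{2r≢0}} q≤p
  p∤2[q+1] : ∀ p → Prime p → p ≢ 2 → q ℕ.≤ p → p ∤ 2 ℕ.* suc q
  p∤2[q+1] p p-prime p≢2 q≤p p∣2[q+1] with euclidsLemma 2 (suc q) p-prime p∣2[q+1]
  ... | inj₁ p∣2 = p≢2 (prime∣prime⇒≡ p-prime prime[2] p∣2)
  ... | inj₂ p∣q+1 with ℕ.m≤n⇒m<n∨m≡n (ℕ∣.∣⇒≤ p∣q+1)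
  ...   | inj₂ refl = p≢2 (sym (prime∣prime⇒≡ prime[2] p-prime 2∣q+1))
    where 2∣q+1 : 2 ∣ suc q
          2∣q+1 = divides (suc r) (cong (λ x → suc (suc x)) (ℕ.*-comm 2 r))
  ...   | inj₁ p≤q with ℕ.≤-antisym (ℕ.≤-pred p≤q) q≤p
  ...     | refl = ¬prime[1] (subst Prime (ℕ∣.∣1⇒≡1 p∣1) p-prime)
    where p∣1 : p ∣ 1
          p∣1 = ℕ∣.∣m+n∣m⇒∣n (subst (p ∣_) (ℕ.+-comm 1 p) p∣q+1) ℕ∣.∣-refl

-- Fixed points of π for K ≡ ±1 (mod 6)

module _ (K : ℕ) (K≡±1 : K % 6 ≡ 1 ⊎ K % 6 ≡ 5) where

  private
    k : ℤ
    k = + K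
    D : ℕ
    D = K ℕ.* K ℕ.+ 4

  k≡1-mod-2 : k ≡ 1ℤ mod + 2
  k≡1-mod-2 = [ (λ K≡1 → mod-∣ℕ 2∣6 (%≡%⇒mod {b = 1} K≡1))
              , (λ K≡5 → mod-trans (mod-∣ℕ 2∣6 (%≡%⇒mod {b = 5} K≡5)) (%≡%⇒mod {5} {1} refl))
              ]′ K≡±1
    where 2∣6 : 2 ∣ 6
          2∣6 = divides 3 refl

  k≡±1-mod-3 : k ≡ 1ℤ mod + 3 ⊎ k ≡ + 2 mod + 3
  k≡±1-mod-3 = Sum.map (λ K≡1 → mod-∣ℕ 3∣6 (%≡%⇒mod {b = 1} K≡1))
                       (λ K≡5 → mod-trans (mod-∣ℕ 3∣6 (%≡%⇒mod {b = 5} K≡5)) (%≡%⇒mod {5} {2} refl))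
                       K≡±1
    where 3∣6 : 3 ∣ 6
          3∣6 = divides 2 refl

  D≡k²+4 : ∀ {c n} → k ≡ c mod n → + D ≡ c * c + + 4 mod n
  D≡k²+4 k≡c = mod-trans (≡⇒mod D≡) (mod-+ʳ (+ 4) (mod-* k≡c k≡c))
    where D≡ : + D ≡ k * k + + 4
          D≡ = trans (ℤ.pos-+ (K ℕ.* K) 4) (cong (_+ + 4) (ℤ.pos-* K K))

  2∤D : 2 ∤ D
  2∤D 2∣D = contradiction (mod⇒%≡% (mod-trans (mod-sym (D≡k²+4 k≡1-mod-2)) (∣⇒≡0-mod-ℕ 2∣D))) λ ()

  3∤D : 3 ∤ D
  3∤D 3∣D = [ (λ k≡1 → contradiction (mod⇒%≡% (c²+4≡0 k≡1)) λ ())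
            , (λ k≡2 → contradiction (mod⇒%≡% (c²+4≡0 k≡2)) λ ())
            ]′ k≡±1-mod-3
    where c²+4≡0 : ∀ {c} → k ≡ c mod + 3 → c * c + + 4 ≡ 0ℤ mod + 3
          c²+4≡0 k≡c = mod-trans (mod-sym (D≡k²+4 k≡c)) (∣⇒≡0-mod-ℕ 3∣D)

  period-of-D-divisor : ∀ {q} → Prime q → q ∣ D → Period k q (4 ℕ.* q)
  period-of-D-divisor {q} q-prime q∣D with even-or-odd q
  ... | inj₁ 2∣q = contradiction (ℕ∣.∣-trans 2∣q q∣D) 2∤D
  ... | inj₂ (r , refl) = period-of-discriminant-divisor {k} {h = suc r} (two-inverse r) k²+4≡0
    where k²+4≡0 : k * k + + 4 ≡ 0ℤ mod + q
          k²+4≡0 = mod-trans (mod-sym (D≡k²+4 mod-refl)) (∣⇒≡0-mod-ℕ q∣D)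

  classify : ∀ q → q ≡ 2 ⊎ q ≡ 3 ⊎ q ∣ D ⊎ (q ≢ 2 × q ≢ 3 × q ∤ D)
  classify q with q ℕ.≟ 2 | q ℕ.≟ 3 | q ℕ∣.∣? D
  ... | yes q≡2 | _       | _       = inj₁ q≡2
  ... | no _    | yes q≡3 | _       = inj₂ (inj₁ q≡3)
  ... | no _    | no _    | yes q∣D = inj₂ (inj₂ (inj₁ q∣D))
  ... | no q≢2  | no q≢3  | no q∤D  = inj₂ (inj₂ (inj₂ (q≢2 , q≢3 , q∤D)))

  module _ (m : ℕ) (1<m : 1 ℕ.< m) .{{_ : NonZero m}} (pisano : IsPisano K m m) where

    m∣periods : DividesPeriods k m
    m∣periods T = pisano-∣ pisano

    m-period : Period k m m
    m-period = isPeriod⇒period (proj₁ pisano)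

    2∣m : 2 ∣ m
    2∣m with even-or-odd m
    ... | inj₁ 2∣m = 2∣m
    ... | inj₂ (t , refl) = contradiction (ℕ.≤-antisym m≤2 1<m) (ℕ.even≢odd 1 t ∘ sym)
      where m≤2 : m ℕ.≤ 2
            m≤2 = ℕ∣.∣⇒≤ (odd-period⇒∣2 {t = t} m-period)

    3∣m : 3 ∣ m
    3∣m = period-mod-2-∣ k≡1-mod-2 (period-mod-∣ 2∣m m-period)

    8∣m : 8 ∣ m
    8∣m = period-mod-3-∣ k≡±1-mod-3 (period-mod-∣ 3∣m m-period)

    -- Descending induction on p: larger primes are already excluded, and the periods at the
    -- smaller primes of m are prime to p.
    no-large-prime : ∀ p → Prime p → p ≢ 2 → p ≢ 3 → p ∤ D → p ∤ m
    no-large-prime = downward-induction (λ p → Prime p → p ≢ 2 → p ≢ 3 → p ∤ D → p ∤ m) m step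
      where
      step : ∀ p → (∀ {q} → p ℕ.< q → q ℕ.≤ m → Prime q → q ≢ 2 → q ≢ 3 → q ∤ D → q ∤ m) →
             Prime p → p ≢ 2 → p ≢ 3 → p ∤ D → p ∤ m
      step p larger p-prime p≢2 p≢3 p∤D p∣m with period-of-discriminant-non-divisor K p-prime p≢2 p∤D
      ... | B , per-p , p∤periods =
        prime-power-obstruction {e = 0} {c = 1} p-prime m∣periods (subst (_∣ m) (sym (ℕ.*-identityʳ p)) p∣m)
          ℕ∣.∣-refl per-p (p∤periods p p-prime p≢2 ℕ.≤-refl) cofactor
        where
        p∤2 : p ∤ 2
        p∤2 p∣2 = p≢2 (prime∣prime⇒≡ p-prime prime[2] p∣2)
        p∤4q : ∀ {q} → Prime q → q ≢ p → p ∤ 4 ℕ.* q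
        p∤4q q-prime q≢p = [ prime∤^ p-prime p∤2 2 , (λ p∣q → q≢p (sym (prime∣prime⇒≡ p-prime q-prime p∣q))) ]′
                           ∘ euclidsLemma 4 _ p-prime
        unit : ∀ {q} → ∃[ O ] p ∤ O × Period k q O → ∃[ O ] p ∤ O × Period k q (1 ℕ.* O)
        unit (O , p∤O , per) = O , p∤O , subst (Period k _) (sym (ℕ.*-identityˡ O)) per
        cofactor : ∀ q → Prime q → q ∣ m → q ≢ p → ∃[ O ] p ∤ O × Period k q (1 ℕ.* O)
        cofactor q q-prime q∣m q≢p with classify q
        ... | inj₁ refl = unit (3 , (λ p∣3 → p≢3 (prime∣prime⇒≡ p-prime prime[3] p∣3)) , period-mod-2 k≡1-mod-2)
        ... | inj₂ (inj₁ refl) = unit (8 , prime∤^ p-prime p∤2 3 , period-mod-3 k≡±1-mod-3)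
        ... | inj₂ (inj₂ (inj₁ q∣D)) = unit (4 ℕ.* q , p∤4q q-prime q≢p , period-of-D-divisor q-prime q∣D)
        ... | inj₂ (inj₂ (inj₂ (q≢2 , q≢3 , q∤D))) with ℕ.<-cmp q p
        ...   | tri< q<p _ _ = let (B′ , per-q , q∤periods) = period-of-discriminant-non-divisor K q-prime q≢2 q∤D
                               in unit (B′ , q∤periods p p-prime p≢2 (ℕ.<⇒≤ q<p) , per-q)
        ...   | tri≈ _ q≡p _ = contradiction q≡p q≢p
        ...   | tri> _ _ p<q = contradiction q∣m (larger p<q (ℕ∣.∣⇒≤ q∣m) q-prime q≢2 q≢3 q∤D)

    16∤m : 16 ∤ m
    16∤m 16∣m = prime-power-obstruction {e = 3} {c = 8} prime[2] m∣periods 16∣m ℕ∣.∣-refl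
                  (period-mod-2 k≡1-mod-2) (from-no (2 ℕ∣.∣? 3)) cofactor
      where
      cofactor : ∀ q → Prime q → q ∣ m → q ≢ 2 → ∃[ O ] 2 ∤ O × Period k q (8 ℕ.* O)
      cofactor q q-prime q∣m q≢2 with classify q
      ... | inj₁ q≡2 = contradiction q≡2 q≢2
      ... | inj₂ (inj₁ refl) = 1 , from-no (2 ℕ∣.∣? 1) , period-mod-3 k≡±1-mod-3
      ... | inj₂ (inj₂ (inj₁ q∣D)) =
        q , (λ 2∣q → 2∤D (ℕ∣.∣-trans 2∣q q∣D)) ,
        periodic-∣ (ℕ∣.*-monoˡ-∣ q (divides {4} {8} 2 refl)) (period-of-D-divisor q-prime q∣D)
      ... | inj₂ (inj₂ (inj₂ (q≢2′ , q≢3 , q∤D))) = contradiction q∣m (no-large-prime q q-prime q≢2′ q≢3 q∤D)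

    9∤m : 9 ∤ m
    9∤m 9∣m = prime-power-obstruction {e = 1} {c = 3} prime[3] m∣periods 9∣m ℕ∣.∣-refl
                (period-mod-3 k≡±1-mod-3) (from-no (3 ℕ∣.∣? 8)) cofactor
      where
      cofactor : ∀ q → Prime q → q ∣ m → q ≢ 3 → ∃[ O ] 3 ∤ O × Period k q (3 ℕ.* O)
      cofactor q q-prime q∣m q≢3 with classify q
      ... | inj₁ refl = 1 , from-no (3 ℕ∣.∣? 1) , period-mod-2 k≡1-mod-2
      ... | inj₂ (inj₁ q≡3) = contradiction q≡3 q≢3
      ... | inj₂ (inj₂ (inj₁ q∣D)) =
        4 ℕ.* q , [ from-no (3 ℕ∣.∣? 4) , (λ 3∣q → 3∤D (ℕ∣.∣-trans 3∣q q∣D)) ]′ ∘ euclidsLemma 4 q prime[3] ,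
        periodic-∣ (ℕ∣.n∣m*n 3) (period-of-D-divisor q-prime q∣D)
      ... | inj₂ (inj₂ (inj₂ (q≢2 , q≢3′ , q∤D))) = contradiction q∣m (no-large-prime q q-prime q≢2 q≢3′ q∤D)

    24∣m : 24 ∣ m
    24∣m = coprime⇒*-∣ (prime∤⇒coprime prime[3] (from-no (3 ℕ∣.∣? 8))) 3∣m 8∣m

    prime-factors-of-cofactor : ∀ {d} → d ℕ.* 24 ≡ m → ∀ q → Prime q → q ∣ d → q ∣ D
    prime-factors-of-cofactor {d} d*24≡m q q-prime q∣d with classify q
    ... | inj₁ refl = contradiction (ℕ∣.∣-trans (divides 3 refl) 48∣m) 16∤m
      where 48∣m : 48 ∣ m
            48∣m = subst (48 ∣_) d*24≡m (ℕ∣.*-monoˡ-∣ {2} {d} 24 q∣d)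
    ... | inj₂ (inj₁ refl) = contradiction (ℕ∣.∣-trans (divides 8 refl) 72∣m) 9∤m
      where 72∣m : 72 ∣ m
            72∣m = subst (72 ∣_) d*24≡m (ℕ∣.*-monoˡ-∣ {3} {d} 24 q∣d)
    ... | inj₂ (inj₂ (inj₁ q∣D)) = q∣D
    ... | inj₂ (inj₂ (inj₂ (q≢2 , q≢3 , q∤D))) =
      contradiction (ℕ∣.∣-trans q∣d (subst (d ∣_) d*24≡m (ℕ∣.m∣m*n 24))) (no-large-prime q q-prime q≢2 q≢3 q∤D)

theorem3p2 : (K : ℕ) → 1 ℕ.≤ K → (K % 6 ≡ 1 ⊎ K % 6 ≡ 5) →
    (m : ℕ) → (1<m : 1 ℕ.< m) → .{{_ : NonZero m}} → IsPisano K m m →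
    Σ ℕ (λ d → (m ≡ 24 ℕ.* d) × (∀ q → Prime q → q ∣ d → q ∣ K ℕ.^ 2 ℕ.+ 4))
-- 1 ≤ K is implied by K ≡ ±1 (mod 6).
theorem3p2 K _ K≡±1 m 1<m pisano = conclude (24∣m K K≡±1 m 1<m pisano)
  where
  conclude : 24 ∣ m → Σ ℕ (λ d → (m ≡ 24 ℕ.* d) × (∀ q → Prime q → q ∣ d → q ∣ K ℕ.^ 2 ℕ.+ 4))
  conclude (divides d m≡d*24) = d , trans m≡d*24 (ℕ.*-comm d 24) , λ q q-prime q∣d →
    subst (λ x → q ∣ K ℕ.* x ℕ.+ 4) (sym (ℕ.*-identityʳ K))
      (prime-factors-of-cofactor K K≡±1 m 1<m pisano (sym m≡d*24) q q-prime q∣d)
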